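{- Let $\mathfrak a=u/w$ with $u,w$ positive integers, $\gcd(u,w)=1$, $w\mid N$. Let $a,d$ be positive integers with $ad=n$, $a\ne d$, and $\gcd(w,N/w)\mid(a-d)$. Then there are exactly $|a-d|$ pairwise $\Gamma_0(N)$-inequivalent (non-conjugate) hyperbolic elements $P\in\Gamma^*$ with $P(\mathfrak a)=\mathfrak a$ and $\Gamma_P=\{1_2\}$ of the form $$P=\frac1{\sqrt n}\sigma_{\mathfrak a}\begin{pmatrix}a&b\\0&d\end{pmatrix}\sigma_{\mathfrak a}^{ -1}\quad\text{with }0\le b<|a-d|.$$
   Context: $N>1$ is an integer that is not square free, $n$ a positive integer with $\gcd(n,N)=1$. $\Gamma_0(N)=\{\begin{pmatrix}\alpha&\beta\\ \gamma&\delta\end{pmatrix}\in SL_2(\mathbb Z):N\mid\gamma\}$ acts on the upper half-plane by Möbius transformations. $\Gamma^*=\bigcup_{ad=n,\,a,d>0,\,0\le b<d}\frac1{\sqrt n}\begin{pmatrix}d&-b\\0&a\end{pmatrix}\Gamma_0(N)$. For $T\in\Gamma^*$, $\Gamma_T$ is the set of elements of $\Gamma_0(N)$ commuting with $T$. $\sigma_{\mathfrak a}=\begin{pmatrix}\mathfrak a\sqrt M&0\\ \sqrt M&1/(\mathfrak a\sqrt M)\end{pmatrix}$ with $M=\operatorname{lcm}(w^2,N)$. -}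

module Defs where

open import Data.Nat as ℕ using (ℕ; zero; suc; NonZero)
open import Data.Nat.Divisibility as ℕD using ()
open import Data.Nat.LCM using (lcm)
open import Data.Integer as ℤ using (ℤ; +_)
open import Data.Rational as ℚ using (ℚ; 0ℚ; 1ℚ)
open import Data.Fin using (Fin)
open import Data.Product using (Σ; ∃; _×_)
open import Data.Sum using (_⊎_)
open import Relation.Nullary using (¬_)
open import Relation.Binary.PropositionalEquality using (_≡_; _≢_)

SquareFree : ℕ → Set
SquareFree N = ∀ m → 1 ℕ.< m → ¬ ((m ℕ.* m) ℕD.∣ N)

record Mat (A : Set) : Set where
  constructor mat
  field
    e11 e12 e21 e22 : A
open Mat public

_*ℤ_ : Mat ℤ → Mat ℤ → Mat ℤ
mat a b c d *ℤ mat a' b' c' d' =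
  mat (a ℤ.* a' ℤ.+ b ℤ.* c') (a ℤ.* b' ℤ.+ b ℤ.* d')
      (c ℤ.* a' ℤ.+ d ℤ.* c') (c ℤ.* b' ℤ.+ d ℤ.* d')

_*ℚ_ : Mat ℚ → Mat ℚ → Mat ℚ
mat a b c d *ℚ mat a' b' c' d' =
  mat (a ℚ.* a' ℚ.+ b ℚ.* c') (a ℚ.* b' ℚ.+ b ℚ.* d')
      (c ℚ.* a' ℚ.+ d ℚ.* c') (c ℚ.* b' ℚ.+ d ℚ.* d')

ℤtoℚ : ℤ → ℚ
ℤtoℚ z = z ℚ./ 1

ℕtoℚ : ℕ → ℚ
ℕtoℚ m = ℤtoℚ (+ m)

-- p/q as a rational (only ever used with q ≠ 0; value 0 for q = 0)
frac : ℕ → ℕ → ℚ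
frac p zero    = 0ℚ
frac p (suc q) = (+ p) ℚ./ suc q

toℚ : Mat ℤ → Mat ℚ
toℚ (mat a b c d) = mat (ℤtoℚ a) (ℤtoℚ b) (ℤtoℚ c) (ℤtoℚ d)

det : Mat ℤ → ℤ
det (mat a b c d) = a ℤ.* d ℤ.- b ℤ.* c

-- adjugate = inverse for determinant-1 matrices
adj : Mat ℤ → Mat ℤ
adj (mat a b c d) = mat d (ℤ.- b) (ℤ.- c) a

idℤ : Mat ℤ
idℤ = mat (+ 1) (+ 0) (+ 0) (+ 1)

negIdℤ : Mat ℤ
negIdℤ = mat (ℤ.- (+ 1)) (+ 0) (+ 0) (ℤ.- (+ 1))

InΓ₀ : ℕ → Mat ℤ → Set
InΓ₀ N γ = (det γ ≡ + 1) × ((+ N) ℤD∣ e21 γ)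
  where open import Data.Integer.Divisibility renaming (_∣_ to _ℤD∣_)

-- Throughout, an element T ∈ Γ* is represented by X = √n·T (a rational matrix).
-- X ∈ √n·Γ*  iff  X = (d' -b' ; 0 a')·γ  with a'd' = n, a',d' > 0, 0 ≤ b' < d', γ ∈ Γ₀(N)
InΓstar : ℕ → ℕ → Mat ℚ → Set
InΓstar N n X =
  Σ ℕ λ a' → Σ ℕ λ d' → Σ ℕ λ b' → Σ (Mat ℤ) λ γ →
    (a' ℕ.* d' ≡ n) × (0 ℕ.< a') × (0 ℕ.< d') × (b' ℕ.< d') × InΓ₀ N γ ×
    (X ≡ toℚ (mat (+ d') (ℤ.- (+ b')) (+ 0) (+ a') *ℤ γ))

trace : Mat ℚ → ℚ
trace X = e11 X ℚ.+ e22 X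

-- T = X/√n is hyperbolic: |tr T| > 2, i.e. (tr X)² > 4n
Hyperbolic : ℕ → Mat ℚ → Set
Hyperbolic n X = ℕtoℚ (4 ℕ.* n) ℚ.< trace X ℚ.* trace X

-- T(q) = q for the Möbius action (same action for X and X/√n):
-- the denominator is nonzero and (x11 q + x12)/(x21 q + x22) = q
Fixes : Mat ℚ → ℚ → Set
Fixes X q = ((e21 X ℚ.* q ℚ.+ e22 X) ≢ 0ℚ) ×
            (e11 X ℚ.* q ℚ.+ e12 X ≡ q ℚ.* (e21 X ℚ.* q ℚ.+ e22 X))

-- Γ_T (elements of Γ₀(N) commuting with T) is trivial, i.e. {±1₂} in SL₂
TrivialCentralizer : ℕ → Mat ℚ → Set
TrivialCentralizer N X =
  ∀ γ → InΓ₀ N γ → (toℚ γ *ℚ X) ≡ (X *ℚ toℚ γ) → (γ ≡ idℤ) ⊎ (γ ≡ negIdℤ)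

Conj : ℕ → Mat ℚ → Mat ℚ → Set
Conj N X Y = Σ (Mat ℤ) λ γ → InΓ₀ N γ × ((toℚ γ *ℚ X) *ℚ toℚ (adj γ) ≡ Y)

-- σ_𝔞 = √M · S  with  S = (u/w 0 ; 1 w/(uM)),  S⁻¹ = (w/u 0 ; -M uM/w),  𝔞 = u/w.
-- The scalar √M cancels in σ_𝔞 U σ_𝔞⁻¹ = S U S⁻¹.
Sσ : ℕ → ℕ → ℕ → Mat ℚ
Sσ u w M = mat (frac u w) 0ℚ 1ℚ (frac w (u ℕ.* M))

Sσinv : ℕ → ℕ → ℕ → Mat ℚ
Sσinv u w M = mat (frac w u) 0ℚ (ℚ.- ℕtoℚ M) (frac (u ℕ.* M) w)

-- √n · P  where  P = (1/√n) σ_𝔞 (a b ; 0 d) σ_𝔞⁻¹,  M = lcm(w², N)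
Pmat : (N u w a d : ℕ) → ℚ → Mat ℚ
Pmat N u w a d b =
  (Sσ u w M *ℚ mat (ℕtoℚ a) b 0ℚ (ℕtoℚ d)) *ℚ Sσinv u w M
  where M = lcm (w ℕ.* w) N

Good : (N n u w a d : ℕ) → ℚ → Set
Good N n u w a d b =
  (0ℚ ℚ.≤ b) × (b ℚ.< ℕtoℚ ℤ.∣ (+ a) ℤ.- (+ d) ∣) ×
  InΓstar N n X × Hyperbolic n X × Fixes X (frac u w) × TrivialCentralizer N X
  where X = Pmat N u w a d b

ExactlyClasses : (N n u w a d k : ℕ) → Set
ExactlyClasses N n u w a d k =
  Σ (Fin k → ℚ) λ rep →
    (∀ i → Good N n u w a d (rep i)) ×
    (∀ i j → Conj N (Pmat N u w a d (rep i)) (Pmat N u w a d (rep j)) → i ≡ j) ×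
    (∀ b → Good N n u w a d b →
       Σ (Fin k) λ i → Conj N (Pmat N u w a d b) (Pmat N u w a d (rep i)))

module Submission where

-- Put Δ = a − d, write lcm(w², N) = K·w² and L = u·K·w.  Conjugating by σ_𝔞 gives
-- √n·P = (a − τ , τ·u/w ; (Δ − τ)·w/u , d + τ) with τ = b·L, which lies in √n·Γ* exactly
-- when τ is an integer t with w ∣ t, u ∣ Δ − t and N ∣ w·(Δ − t)/u: an integer matrix of
-- determinant n with N ∣ c always factors as (d′ −b′ ; 0 a′)·γ.  These t form one residue
-- class modulo L, non-empty because gcd(w, N/w) ∣ Δ, so exactly |Δ| values of b in [0, |Δ|)
-- qualify.  Each such matrix has (u , w) as eigenvector for a, hence fixes 𝔞, and its trace
-- a + d makes it hyperbolic.  If γ ∈ Γ₀(N) conjugates P_t to P_t′, then γ preserves that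
-- eigenline, so γ = ±1 + β·(u , w)ᵀ(w , −u) with N ∣ β·w², i.e. K ∣ β, and comparing (1,1)
-- entries gives ±(t′ − t) = β·u·w·Δ ∈ L·Δ·ℤ.  So distinct admissible b are never conjugate,
-- and for t = t′ we get β = 0: the centraliser is {±1}.

open import Data.Nat as ℕ using (ℕ; zero; suc; NonZero)
import Data.Nat.Properties as ℕP
import Data.Nat.Divisibility as ℕD
import Data.Nat.Coprimality as ℕC
open import Data.Nat.GCD using (gcd; gcd-GCD; gcd[m,n]∣m; gcd[m,n]∣n; gcd-greatest; module Bézout)
open import Data.Nat.LCM using (lcm; m∣lcm[m,n]; n∣lcm[m,n]; lcm-least; gcd*lcm)
import Data.Nat.Tactic.RingSolver as ℕSolver
open import Data.Integer as ℤ using (ℤ; +_; -[1+_]; 0ℤ; 1ℤ; -1ℤ)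
import Data.Integer.Properties as ℤP
open import Data.Integer.Coprimality using (Coprime; coprime-divisor)
import Data.Integer.Coprimality as ℤC
import Data.Integer.Divisibility as ℤD
open import Data.Integer.Divisibility.Signed
  using (divides; ∣ᵤ⇒∣; ∣⇒∣ᵤ; ∣m∣n⇒∣m+n; ∣m∣n⇒∣m-n; ∣n⇒∣m*n; ∣m⇒∣m*n) renaming (_∣_ to _∣ˢ_)
open import Data.Nat.DivMod using (m*n/n≡m)
open import Data.Integer.DivMod using (_%ℕ_; _/ℕ_; a≡a%ℕn+[a/ℕn]*n; n%ℕd<d)
open import Data.Integer.Tactic.RingSolver using (solve)
open import Data.Rational as ℚ using (ℚ; 0ℚ; 1ℚ; toℚᵘ; fromℚᵘ)
import Data.Rational.Properties as ℚP
open import Data.Rational.Unnormalised as ℚᵘ using (ℚᵘ; mkℚᵘ; *≡*; *≤*; *<*)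
import Data.Rational.Unnormalised.Properties as ℚᵘP
import Tactic.RingSolver as RingSolver
import Tactic.RingSolver.Core.AlmostCommutativeRing as ACR
open import Data.Fin using (Fin; toℕ; fromℕ<)
import Data.Fin.Properties as FinP
open import Data.List.Base using (_∷_; [])
open import Data.Product using (Σ; _×_; _,_; proj₁; proj₂)
open import Data.Sum using (_⊎_; inj₁; inj₂)
open import Data.Empty using (⊥-elim)
open import Function using (_∘_)
open import Level using (0ℓ)
open import Relation.Nullary using (¬_)
open import Relation.Nullary.Decidable using (dec⇒maybe)
open import Relation.Binary.PropositionalEquality
open import Defs

module RationalEmbedding where

  open import Data.Integer using (_+_; _*_; _-_)

  ℚ-ring : ACR.AlmostCommutativeRing 0ℓ 0ℓ
  ℚ-ring = ACR.fromCommutativeRing ℚP.+-*-commutativeRing (λ x → dec⇒maybe (0ℚ ℚP.≟ x))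

  module _ where
    open ℚᵘP.≃-Reasoning

    fromℚᵘ-homo-+ : ∀ p q → fromℚᵘ (p ℚᵘ.+ q) ≡ fromℚᵘ p ℚ.+ fromℚᵘ q
    fromℚᵘ-homo-+ p q = ℚP.toℚᵘ-injective (begin
      toℚᵘ (fromℚᵘ (p ℚᵘ.+ q))              ≈⟨ ℚP.toℚᵘ-fromℚᵘ (p ℚᵘ.+ q) ⟩
      p ℚᵘ.+ q                              ≈⟨ ℚᵘP.+-cong (ℚP.toℚᵘ-fromℚᵘ p) (ℚP.toℚᵘ-fromℚᵘ q) ⟨
      toℚᵘ (fromℚᵘ p) ℚᵘ.+ toℚᵘ (fromℚᵘ q)  ≈⟨ ℚP.toℚᵘ-homo-+ (fromℚᵘ p) (fromℚᵘ q) ⟨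
      toℚᵘ (fromℚᵘ p ℚ.+ fromℚᵘ q)          ∎)

    fromℚᵘ-homo-* : ∀ p q → fromℚᵘ (p ℚᵘ.* q) ≡ fromℚᵘ p ℚ.* fromℚᵘ q
    fromℚᵘ-homo-* p q = ℚP.toℚᵘ-injective (begin
      toℚᵘ (fromℚᵘ (p ℚᵘ.* q))              ≈⟨ ℚP.toℚᵘ-fromℚᵘ (p ℚᵘ.* q) ⟩
      p ℚᵘ.* q                              ≈⟨ ℚᵘP.*-cong (ℚP.toℚᵘ-fromℚᵘ p) (ℚP.toℚᵘ-fromℚᵘ q) ⟨
      toℚᵘ (fromℚᵘ p) ℚᵘ.* toℚᵘ (fromℚᵘ q)  ≈⟨ ℚP.toℚᵘ-homo-* (fromℚᵘ p) (fromℚᵘ q) ⟨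
      toℚᵘ (fromℚᵘ p ℚ.* fromℚᵘ q)          ∎)

    fromℚᵘ-homo‿- : ∀ p → fromℚᵘ (ℚᵘ.- p) ≡ ℚ.- fromℚᵘ p
    fromℚᵘ-homo‿- p = ℚP.toℚᵘ-injective (begin
      toℚᵘ (fromℚᵘ (ℚᵘ.- p))   ≈⟨ ℚP.toℚᵘ-fromℚᵘ (ℚᵘ.- p) ⟩
      ℚᵘ.- p                   ≈⟨ ℚᵘP.-‿cong (ℚP.toℚᵘ-fromℚᵘ p) ⟨
      ℚᵘ.- toℚᵘ (fromℚᵘ p)     ≈⟨ ℚP.toℚᵘ-homo‿- (fromℚᵘ p) ⟨
      toℚᵘ (ℚ.- fromℚᵘ p)      ∎)

  -- ℤtoℚ i is definitionally fromℚᵘ (mkℚᵘ i 0).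
  ℤtoℚ-homo-+ : ∀ i j → ℤtoℚ (i ℤ.+ j) ≡ ℤtoℚ i ℚ.+ ℤtoℚ j
  ℤtoℚ-homo-+ i j =
    trans (ℚP.fromℚᵘ-cong {mkℚᵘ (i ℤ.+ j) 0} {mkℚᵘ i 0 ℚᵘ.+ mkℚᵘ j 0}
            (*≡* (cong (ℤ._* + 1) (cong₂ ℤ._+_ (sym (ℤP.*-identityʳ i)) (sym (ℤP.*-identityʳ j))))))
          (fromℚᵘ-homo-+ (mkℚᵘ i 0) (mkℚᵘ j 0))

  ℤtoℚ-homo-* : ∀ i j → ℤtoℚ (i ℤ.* j) ≡ ℤtoℚ i ℚ.* ℤtoℚ j
  ℤtoℚ-homo-* i j = fromℚᵘ-homo-* (mkℚᵘ i 0) (mkℚᵘ j 0)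

  ℤtoℚ-homo‿- : ∀ i → ℤtoℚ (ℤ.- i) ≡ ℚ.- ℤtoℚ i
  ℤtoℚ-homo‿- i = fromℚᵘ-homo‿- (mkℚᵘ i 0)

  ℤtoℚ-homo-minus : ∀ i j → ℤtoℚ (i ℤ.- j) ≡ ℤtoℚ i ℚ.- ℤtoℚ j
  ℤtoℚ-homo-minus i j = trans (ℤtoℚ-homo-+ i (ℤ.- j)) (cong (ℤtoℚ i ℚ.+_) (ℤtoℚ-homo‿- j))

  toℚᵘ-ℤtoℚ : ∀ i → toℚᵘ (ℤtoℚ i) ℚᵘ.≃ mkℚᵘ i 0
  toℚᵘ-ℤtoℚ i = ℚP.toℚᵘ-fromℚᵘ (mkℚᵘ i 0)

  ℤtoℚ-injective : ∀ {i j} → ℤtoℚ i ≡ ℤtoℚ j → i ≡ j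
  ℤtoℚ-injective {i} {j} eq
    with *≡* i*1≡j*1 ← ℚᵘP.≃-trans (ℚᵘP.≃-sym (toℚᵘ-ℤtoℚ i)) (ℚᵘP.≃-trans (ℚP.toℚᵘ-cong eq) (toℚᵘ-ℤtoℚ j))
    = trans (sym (ℤP.*-identityʳ i)) (trans i*1≡j*1 (ℤP.*-identityʳ j))

  ℤtoℚ-mono-≤ : ∀ {i j} → i ℤ.≤ j → ℤtoℚ i ℚ.≤ ℤtoℚ j
  ℤtoℚ-mono-≤ {i} {j} i≤j = ℚP.toℚᵘ-cancel-≤
    (ℚᵘP.≤-respˡ-≃ (ℚᵘP.≃-sym (toℚᵘ-ℤtoℚ i)) (ℚᵘP.≤-respʳ-≃ (ℚᵘP.≃-sym (toℚᵘ-ℤtoℚ j))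
      (*≤* (ℤP.*-monoʳ-≤-nonNeg (+ 1) i≤j))))

  ℤtoℚ-mono-< : ∀ {i j} → i ℤ.< j → ℤtoℚ i ℚ.< ℤtoℚ j
  ℤtoℚ-mono-< {i} {j} i<j = ℚP.toℚᵘ-cancel-<
    (ℚᵘP.<-respˡ-≃ (ℚᵘP.≃-sym (toℚᵘ-ℤtoℚ i)) (ℚᵘP.<-respʳ-≃ (ℚᵘP.≃-sym (toℚᵘ-ℤtoℚ j))
      (*<* (ℤP.*-monoʳ-<-pos (+ 1) i<j))))

  ℤtoℚ-cancel-≤ : ∀ {i j} → ℤtoℚ i ℚ.≤ ℤtoℚ j → i ℤ.≤ j
  ℤtoℚ-cancel-≤ {i} {j} le
    with *≤* i*1≤j*1 ← ℚᵘP.≤-respˡ-≃ (toℚᵘ-ℤtoℚ i) (ℚᵘP.≤-respʳ-≃ (toℚᵘ-ℤtoℚ j) (ℚP.toℚᵘ-mono-≤ le))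
    = ℤP.*-cancelʳ-≤-pos i j (+ 1) i*1≤j*1

  ℤtoℚ-cancel-< : ∀ {i j} → ℤtoℚ i ℚ.< ℤtoℚ j → i ℤ.< j
  ℤtoℚ-cancel-< {i} {j} lt
    with *<* i*1<j*1 ← ℚᵘP.<-respˡ-≃ (toℚᵘ-ℤtoℚ i) (ℚᵘP.<-respʳ-≃ (toℚᵘ-ℤtoℚ j) (ℚP.toℚᵘ-mono-< lt))
    = ℤP.*-cancelʳ-<-nonNeg (+ 1) i*1<j*1

  ℕtoℚ-homo-* : ∀ m n → ℕtoℚ (m ℕ.* n) ≡ ℕtoℚ m ℚ.* ℕtoℚ n
  ℕtoℚ-homo-* m n = trans (cong ℤtoℚ (ℤP.pos-* m n)) (ℤtoℚ-homo-* (+ m) (+ n))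

  frac-* : ∀ p q .{{_ : NonZero q}} → frac p q ℚ.* ℕtoℚ q ≡ ℕtoℚ p
  frac-* p (suc q) =
    trans (sym (fromℚᵘ-homo-* (mkℚᵘ (+ p) q) (mkℚᵘ (+ suc q) 0)))
          (ℚP.fromℚᵘ-cong {mkℚᵘ (+ p) q ℚᵘ.* mkℚᵘ (+ suc q) 0} {mkℚᵘ (+ p) 0}
            (*≡* (trans (ℤP.*-identityʳ _) (cong (λ k → + p ℤ.* + suc k) (sym (ℕP.*-identityʳ q))))))

  *-cancelʳ-ℕtoℚ : ∀ q .{{_ : NonZero q}} {x y} → x ℚ.* ℕtoℚ q ≡ y ℚ.* ℕtoℚ q → x ≡ y
  *-cancelʳ-ℕtoℚ q {x} {y} eq = begin
    x                            ≡⟨ ℚP.*-identityʳ x ⟨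
    x ℚ.* 1ℚ                     ≡⟨ cong (x ℚ.*_) q*q⁻¹≡1 ⟨
    x ℚ.* (ℕtoℚ q ℚ.* q⁻¹)       ≡⟨ ℚP.*-assoc x (ℕtoℚ q) q⁻¹ ⟨
    x ℚ.* ℕtoℚ q ℚ.* q⁻¹         ≡⟨ cong (ℚ._* q⁻¹) eq ⟩
    y ℚ.* ℕtoℚ q ℚ.* q⁻¹         ≡⟨ ℚP.*-assoc y (ℕtoℚ q) q⁻¹ ⟩
    y ℚ.* (ℕtoℚ q ℚ.* q⁻¹)       ≡⟨ cong (y ℚ.*_) q*q⁻¹≡1 ⟩
    y ℚ.* 1ℚ                     ≡⟨ ℚP.*-identityʳ y ⟩
    y                            ∎
    where
    open ≡-Reasoning
    q⁻¹ : ℚ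
    q⁻¹ = frac 1 q
    q*q⁻¹≡1 : ℕtoℚ q ℚ.* q⁻¹ ≡ 1ℚ
    q*q⁻¹≡1 = trans (ℚP.*-comm (ℕtoℚ q) q⁻¹) (frac-* 1 q)

  ℤtoℚ-linear : ∀ a x b y → ℤtoℚ (a * x + b * y) ≡ ℤtoℚ a ℚ.* ℤtoℚ x ℚ.+ ℤtoℚ b ℚ.* ℤtoℚ y
  ℤtoℚ-linear a x b y = trans (ℤtoℚ-homo-+ (a * x) (b * y)) (cong₂ ℚ._+_ (ℤtoℚ-homo-* a x) (ℤtoℚ-homo-* b y))

  ℤtoℚ-*-frac : ∀ m x y .{{_ : NonZero y}} → ℤtoℚ (m * + y) ℚ.* frac x y ≡ ℤtoℚ (m * + x)
  ℤtoℚ-*-frac m x y = begin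
    ℤtoℚ (m * + y) ℚ.* frac x y          ≡⟨ cong (ℚ._* frac x y) (ℤtoℚ-homo-* m (+ y)) ⟩
    ℤtoℚ m ℚ.* ℕtoℚ y ℚ.* frac x y       ≡⟨ ℚP.*-assoc (ℤtoℚ m) (ℕtoℚ y) (frac x y) ⟩
    ℤtoℚ m ℚ.* (ℕtoℚ y ℚ.* frac x y)     ≡⟨ cong (ℤtoℚ m ℚ.*_) (ℚP.*-comm (ℕtoℚ y) (frac x y)) ⟩
    ℤtoℚ m ℚ.* (frac x y ℚ.* ℕtoℚ y)     ≡⟨ cong (ℤtoℚ m ℚ.*_) (frac-* x y) ⟩
    ℤtoℚ m ℚ.* ℕtoℚ x                    ≡⟨ ℤtoℚ-homo-* m (+ x) ⟨
    ℤtoℚ (m * + x)                       ∎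
    where open ≡-Reasoning

  ℤtoℚ-homo-minus₂ : ∀ i j k → ℤtoℚ (i - j - k) ≡ ℤtoℚ i ℚ.- ℤtoℚ j ℚ.- ℤtoℚ k
  ℤtoℚ-homo-minus₂ i j k = trans (ℤtoℚ-homo-minus (i - j) k) (cong (λ e → e ℚ.- ℤtoℚ k) (ℤtoℚ-homo-minus i j))

  frac-unique : ∀ p q .{{_ : NonZero q}} {x} → x ℚ.* ℕtoℚ q ≡ ℕtoℚ p → frac p q ≡ x
  frac-unique p q eq = *-cancelʳ-ℕtoℚ q (trans (frac-* p q) (sym eq))

  frac-cross : ∀ i z p q .{{_ : NonZero q}} → ℤtoℚ i ℚ.* frac p q ≡ ℤtoℚ z → z * + q ≡ i * + p
  frac-cross i z p q eq = ℤtoℚ-injective (begin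
    ℤtoℚ (z * + q)                      ≡⟨ ℤtoℚ-homo-* z (+ q) ⟩
    ℤtoℚ z ℚ.* ℕtoℚ q                   ≡⟨ cong (ℚ._* ℕtoℚ q) eq ⟨
    ℤtoℚ i ℚ.* frac p q ℚ.* ℕtoℚ q      ≡⟨ ℚP.*-assoc (ℤtoℚ i) (frac p q) (ℕtoℚ q) ⟩
    ℤtoℚ i ℚ.* (frac p q ℚ.* ℕtoℚ q)    ≡⟨ cong (ℤtoℚ i ℚ.*_) (frac-* p q) ⟩
    ℤtoℚ i ℚ.* ℕtoℚ p                   ≡⟨ ℤtoℚ-homo-* i (+ p) ⟨
    ℤtoℚ (i * + p)                      ∎)
    where open ≡-Reasoning

module Arithmetic where

  open import Data.Integer using (_+_; _*_; _-_; -_)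

  IsSign : ℤ → Set
  IsSign ε = ε ≡ 1ℤ ⊎ ε ≡ -1ℤ

  coprime-divisorˢ : ∀ i j k → Coprime i j → i ∣ˢ j * k → i ∣ˢ k
  coprime-divisorˢ i j k i⊥j i∣jk = ∣ᵤ⇒∣ (coprime-divisor i j k i⊥j (∣⇒∣ᵤ i∣jk))

  private
    ∣i∣≡1⇒i*j≡1⇒±1 : ∀ i j → ℤ.∣ i ∣ ≡ 1 → i * j ≡ 1ℤ → IsSign i × j ≡ i
    ∣i∣≡1⇒i*j≡1⇒±1 (+ 1)           j _ ij≡1 = inj₁ refl , trans (sym (ℤP.*-identityˡ j)) ij≡1
    ∣i∣≡1⇒i*j≡1⇒±1 -[1+ 0 ]        j _ ij≡1 =
      inj₂ refl , trans (sym (ℤP.neg-involutive j)) (cong -_ (trans (sym (ℤP.-1*i≡-i j)) ij≡1))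
    ∣i∣≡1⇒i*j≡1⇒±1 (+ 0)           j () _
    ∣i∣≡1⇒i*j≡1⇒±1 (+ suc (suc _)) j () _
    ∣i∣≡1⇒i*j≡1⇒±1 -[1+ suc _ ]    j () _

  i*j≡1⇒±1 : ∀ i j → i * j ≡ 1ℤ → IsSign i × j ≡ i
  i*j≡1⇒±1 i j ij≡1 = ∣i∣≡1⇒i*j≡1⇒±1 i j
    (ℕP.m*n≡1⇒m≡1 ℤ.∣ i ∣ ℤ.∣ j ∣ (trans (sym (ℤP.abs-* i j)) (cong ℤ.∣_∣ ij≡1))) ij≡1

  abs-as-multiple : ∀ i → Σ ℤ λ σ → + ℤ.∣ i ∣ ≡ σ * i
  abs-as-multiple (+ n)    = 1ℤ , sym (ℤP.*-identityˡ (+ n))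
  abs-as-multiple -[1+ n ] = -1ℤ , sym (ℤP.-1*i≡-i -[1+ n ])

  g+b≡a⇒a-b≡g : ∀ g a b → g ℕ.+ b ≡ a → + a - + b ≡ + g
  g+b≡a⇒a-b≡g g a b refl = begin
    + (g ℕ.+ b) - + b   ≡⟨ cong (_- + b) (ℤP.pos-+ g b) ⟩
    + g + + b - + b     ≡⟨ i+j-j≡i (+ g) (+ b) ⟩
    + g                 ∎
    where
    open ≡-Reasoning
    i+j-j≡i : ∀ i j → i + j - j ≡ i
    i+j-j≡i i j = solve (i ∷ j ∷ [])

  bézout-ℕ : ∀ m n → Σ ℤ λ P → Σ ℤ λ Q → P * + m + Q * + n ≡ + gcd m n
  bézout-ℕ m n = from-identity (Bézout.identity (gcd-GCD m n))
    where
    open ≡-Reasoning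
    from-identity : Bézout.Identity (gcd m n) m n → Σ ℤ λ P → Σ ℤ λ Q → P * + m + Q * + n ≡ + gcd m n
    from-identity (Bézout.+- x y eq) = + x , - + y , (begin
      + x * + m + - + y * + n   ≡⟨ cong₂ _+_ (ℤP.pos-* x m) (ℤP.neg-distribˡ-* (+ y) (+ n)) ⟨
      + (x ℕ.* m) - + y * + n   ≡⟨ cong (λ e → + (x ℕ.* m) - e) (ℤP.pos-* y n) ⟨
      + (x ℕ.* m) - + (y ℕ.* n) ≡⟨ g+b≡a⇒a-b≡g (gcd m n) (x ℕ.* m) (y ℕ.* n) eq ⟩
      + gcd m n                 ∎)
    from-identity (Bézout.-+ x y eq) = - + x , + y , (begin
      - + x * + m + + y * + n   ≡⟨ ℤP.+-comm (- + x * + m) (+ y * + n) ⟩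
      + y * + n + - + x * + m   ≡⟨ cong₂ _+_ (ℤP.pos-* y n) (ℤP.neg-distribˡ-* (+ x) (+ m)) ⟨
      + (y ℕ.* n) - + x * + m   ≡⟨ cong (λ e → + (y ℕ.* n) - e) (ℤP.pos-* x m) ⟨
      + (y ℕ.* n) - + (x ℕ.* m) ≡⟨ g+b≡a⇒a-b≡g (gcd m n) (y ℕ.* n) (x ℕ.* m) eq ⟩
      + gcd m n                 ∎)

  bézout : ∀ i j → Σ ℤ λ P → Σ ℤ λ Q → P * i + Q * j ≡ + gcd ℤ.∣ i ∣ ℤ.∣ j ∣
  bézout i j = combine (bézout-ℕ ℤ.∣ i ∣ ℤ.∣ j ∣) (abs-as-multiple i) (abs-as-multiple j)
    where
    open ≡-Reasoning
    combine : (Σ ℤ λ P → Σ ℤ λ Q → P * + ℤ.∣ i ∣ + Q * + ℤ.∣ j ∣ ≡ + gcd ℤ.∣ i ∣ ℤ.∣ j ∣) →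
              (Σ ℤ λ σ → + ℤ.∣ i ∣ ≡ σ * i) → (Σ ℤ λ τ → + ℤ.∣ j ∣ ≡ τ * j) →
              Σ ℤ λ P → Σ ℤ λ Q → P * i + Q * j ≡ + gcd ℤ.∣ i ∣ ℤ.∣ j ∣
    combine (P , Q , eq) (σ , ∣i∣≡σi) (τ , ∣j∣≡τj) = P * σ , Q * τ , (begin
      P * σ * i + Q * τ * j          ≡⟨ cong₂ _+_ (ℤP.*-assoc P σ i) (ℤP.*-assoc Q τ j) ⟩
      P * (σ * i) + Q * (τ * j)      ≡⟨ cong₂ (λ e f → P * e + Q * f) ∣i∣≡σi ∣j∣≡τj ⟨
      P * + ℤ.∣ i ∣ + Q * + ℤ.∣ j ∣  ≡⟨ eq ⟩
      + gcd ℤ.∣ i ∣ ℤ.∣ j ∣          ∎)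

  coprime-to-divisor : ∀ {n N g} → gcd n N ≡ 1 → g ℕD.∣ n → ℕC.Coprime N g
  coprime-to-divisor gcd≡1 g∣n (k∣N , k∣g) =
    ℕD.∣1⇒≡1 (subst (_ ℕD.∣_) gcd≡1 (gcd-greatest (ℕD.∣-trans k∣g g∣n) k∣N))

  positive-factor : ∀ i g n → i * + suc g ≡ + suc n → Σ ℕ λ d → i ≡ + suc d
  positive-factor (+ suc d)  _ _ _  = d , refl
  positive-factor (+ zero)   _ _ ()
  positive-factor -[1+ _ ]   _ _ ()

  ∣+i-+j∣<m : ∀ {m} i j → i ℕ.< m → j ℕ.< m → ℤ.∣ + i - + j ∣ ℕ.< m
  ∣+i-+j∣<m {m} i j i<m j<m with ℕP.≤-total j i
  ... | inj₁ j≤i = subst (ℕ._< m) (cong ℤ.∣_∣ (trans (sym (ℤP.⊖-≥ j≤i)) (sym (ℤP.m-n≡m⊖n i j))))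
                         (ℕP.≤-<-trans (ℕP.m∸n≤m i j) i<m)
  ... | inj₂ i≤j = subst (ℕ._< m) (trans (cong ℤ.∣_∣ (sym (ℤP.⊖-≥ i≤j)))
                                          (trans (ℤP.∣m⊖n∣≡∣n⊖m∣ j i) (cong ℤ.∣_∣ (sym (ℤP.m-n≡m⊖n i j)))))
                         (ℕP.≤-<-trans (ℕP.m∸n≤m j i) j<m)

  ∣-small⇒0 : ∀ {m k} → m ℕD.∣ k → k ℕ.< m → k ≡ 0
  ∣-small⇒0 {k = zero}  _   _   = refl
  ∣-small⇒0 {k = suc _} m∣k k<m = ⊥-elim (ℕP.<⇒≱ k<m (ℕD.∣⇒≤ m∣k))

  difference-divisible⇒≡ : ∀ {m} i j → i ℕ.< m → j ℕ.< m → (+ m) ℤD.∣ (+ i - + j) → i ≡ j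
  difference-divisible⇒≡ i j i<m j<m m∣i-j = ℤP.+-injective (ℤP.i-j≡0⇒i≡j (+ i) (+ j)
    (ℤP.∣i∣≡0⇒i≡0 (∣-small⇒0 m∣i-j (∣+i-+j∣<m i j i<m j<m))))

  window-index : ∀ L .{{_ : NonZero L}} r k J → r ℕ.< L →
                 0ℤ ℤ.≤ + r + J * + L → + r + J * + L ℤ.< + (k ℕ.* L) → Σ ℕ λ j → J ≡ + j × j ℕ.< k
  window-index L r k (+ j) r<L _ r+jL<kL =
    j , refl , ℕP.*-cancelʳ-< L j k (ℕP.≤-<-trans (ℕP.m≤n+m (j ℕ.* L) r)
                 (ℤP.drop‿+<+ (subst (ℤ._< + (k ℕ.* L)) (sym r+jL≡) r+jL<kL)))
    where
    r+jL≡ : + (r ℕ.+ j ℕ.* L) ≡ + r + + j * + L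
    r+jL≡ = trans (ℤP.pos-+ r (j ℕ.* L)) (cong (λ e → + r + e) (ℤP.pos-* j L))
  window-index L r k J@(-[1+ j ]) r<L 0≤t _ = ⊥-elim (impossible (ℤP.*-cancelʳ-<-nonNeg (+ L) -L<JL))
    where
    impossible : ¬ (-1ℤ ℤ.< -[1+ j ])
    impossible (ℤ.-<- ())
    cancel : ∀ x y → x + y + - x ≡ y
    cancel x y = solve (x ∷ y ∷ [])
    open ℤP.≤-Reasoning
    -L<JL : -1ℤ * + L ℤ.< J * + L
    -L<JL = begin-strict
      -1ℤ * + L            ≡⟨ ℤP.-1*i≡-i (+ L) ⟩
      - + L                <⟨ ℤP.neg-mono-< (ℤ.+<+ r<L) ⟩
      - + r                ≡⟨ ℤP.+-identityˡ (- + r) ⟨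
      0ℤ + - + r           ≤⟨ ℤP.+-monoˡ-≤ (- + r) 0≤t ⟩
      + r + J * + L + - + r ≡⟨ cancel (+ r) (J * + L) ⟩
      J * + L              ∎

  0<i*i : ∀ i → i ≢ 0ℤ → 0ℤ ℤ.< i * i
  0<i*i (+ zero)   i≢0 = ⊥-elim (i≢0 refl)
  0<i*i (+ suc _)  _   = ℤ.+<+ (ℕ.s≤s ℕ.z≤n)
  0<i*i -[1+ _ ]   _   = ℤ.+<+ (ℕ.s≤s ℕ.z≤n)

  4ij<[i+j]² : ∀ i j → i ≢ j → + 4 * (i * j) ℤ.< (i + j) * (i + j)
  4ij<[i+j]² i j i≢j = subst₂ ℤ._<_ (ℤP.+-identityʳ (+ 4 * (i * j))) (sym square)
    (ℤP.+-monoʳ-< (+ 4 * (i * j)) (0<i*i (i - j) (λ i-j≡0 → i≢j (ℤP.i-j≡0⇒i≡j i j i-j≡0))))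
    where
    square : (i + j) * (i + j) ≡ + 4 * (i * j) + (i - j) * (i - j)
    square = solve (i ∷ j ∷ [])

  ε*x≡y⇒x≡ε*y : ∀ {ε x y} → IsSign ε → ε * x ≡ y → x ≡ ε * y
  ε*x≡y⇒x≡ε*y {x = x} {y} (inj₁ refl) εx≡y = trans (sym (ℤP.*-identityˡ x)) (trans εx≡y (sym (ℤP.*-identityˡ y)))
  ε*x≡y⇒x≡ε*y {x = x} {y} (inj₂ refl) εx≡y = begin
    x             ≡⟨ ℤP.neg-involutive x ⟨
    - - x         ≡⟨ cong -_ (ℤP.-1*i≡-i x) ⟨
    - (-1ℤ * x)   ≡⟨ cong -_ εx≡y ⟩
    - y           ≡⟨ ℤP.-1*i≡-i y ⟨
    -1ℤ * y       ∎
    where open ≡-Reasoning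

  lcm-cofactor : ∀ m n .{{_ : NonZero m}} .{{_ : NonZero n}} → Σ ℕ λ K → NonZero K × lcm m n ≡ K ℕ.* m
  lcm-cofactor m n = from-divisor (m∣lcm[m,n] m n)
    where
    from-divisor : m ℕD.∣ lcm m n → Σ ℕ λ K → NonZero K × lcm m n ≡ K ℕ.* m
    from-divisor (ℕD.divides K lcm≡Km) = K , ℕ.≢-nonZero K≢0 , lcm≡Km
      where
      open ≡-Reasoning
      K≢0 : K ≢ 0
      K≢0 K≡0 = ℕ.≢-nonZero⁻¹ (m ℕ.* n) {{ℕP.m*n≢0 m n}} (begin
        m ℕ.* n                  ≡⟨ gcd*lcm m n ⟨
        gcd m n ℕ.* lcm m n      ≡⟨ cong (gcd m n ℕ.*_) (trans lcm≡Km (cong (ℕ._* m) K≡0)) ⟩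
        gcd m n ℕ.* 0            ≡⟨ ℕP.*-zeroʳ (gcd m n) ⟩
        0                        ∎)

module Matrices where

  open import Data.Integer using (_+_; _*_; _-_; -_)
  open RationalEmbedding

  mat-cong : ∀ {A : Set} {a b c d a′ b′ c′ d′ : A} →
             a ≡ a′ → b ≡ b′ → c ≡ c′ → d ≡ d′ → mat a b c d ≡ mat a′ b′ c′ d′
  mat-cong refl refl refl refl = refl

  Vec2 : Set
  Vec2 = ℤ × ℤ

  _⊙_ : Mat ℤ → Vec2 → Vec2
  mat a b c d ⊙ (x , y) = (a * x + b * y , c * x + d * y)

  _·_ : ℤ → Vec2 → Vec2
  k · (x , y) = (k * x , k * y)

  ⊙-*ℤ : ∀ P Q v → (P *ℤ Q) ⊙ v ≡ P ⊙ (Q ⊙ v)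
  ⊙-*ℤ (mat a b c d) (mat a′ b′ c′ d′) (x , y) = cong₂ _,_ (row a b) (row c d)
    where
    row : ∀ e f → (e * a′ + f * c′) * x + (e * b′ + f * d′) * y ≡ e * (a′ * x + b′ * y) + f * (c′ * x + d′ * y)
    row e f = solve (e ∷ f ∷ a′ ∷ b′ ∷ c′ ∷ d′ ∷ x ∷ y ∷ [])

  ⊙-· : ∀ P k v → P ⊙ (k · v) ≡ k · (P ⊙ v)
  ⊙-· (mat a b c d) k (x , y) = cong₂ _,_ (row a b) (row c d)
    where
    row : ∀ e f → e * (k * x) + f * (k * y) ≡ k * (e * x + f * y)
    row e f = solve (e ∷ f ∷ k ∷ x ∷ y ∷ [])

  intertwine-eigenvector : ∀ {γ X Y k v} → γ *ℤ X ≡ Y *ℤ γ → X ⊙ v ≡ k · v →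
                           Y ⊙ (γ ⊙ v) ≡ k · (γ ⊙ v)
  intertwine-eigenvector {γ} {X} {Y} {k} {v} γX≡Yγ Xv≡kv = begin
    Y ⊙ (γ ⊙ v)   ≡⟨ ⊙-*ℤ Y γ v ⟨
    (Y *ℤ γ) ⊙ v  ≡⟨ cong (_⊙ v) γX≡Yγ ⟨
    (γ *ℤ X) ⊙ v  ≡⟨ ⊙-*ℤ γ X v ⟩
    γ ⊙ (X ⊙ v)   ≡⟨ cong (γ ⊙_) Xv≡kv ⟩
    γ ⊙ (k · v)   ≡⟨ ⊙-· γ k v ⟩
    k · (γ ⊙ v)   ∎
    where open ≡-Reasoning

  toℚ-homo-* : ∀ X Y → toℚ (X *ℤ Y) ≡ toℚ X *ℚ toℚ Y
  toℚ-homo-* (mat a b c d) (mat a′ b′ c′ d′) =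
    mat-cong (ℤtoℚ-linear a a′ b c′) (ℤtoℚ-linear a b′ b d′) (ℤtoℚ-linear c a′ d c′) (ℤtoℚ-linear c b′ d d′)

  toℚ-injective : ∀ {X Y} → toℚ X ≡ toℚ Y → X ≡ Y
  toℚ-injective {mat _ _ _ _} {mat _ _ _ _} eq =
    mat-cong (ℤtoℚ-injective (cong e11 eq)) (ℤtoℚ-injective (cong e12 eq))
             (ℤtoℚ-injective (cong e21 eq)) (ℤtoℚ-injective (cong e22 eq))

  *-adj-cancelʳ : ∀ K γ → det γ ≡ 1ℤ → (K *ℤ adj γ) *ℤ γ ≡ K
  *-adj-cancelʳ (mat k l m n) (mat p q r z) det≡1 = mat-cong (row k l) (col k l) (row m n) (col m n)
    where
    open ≡-Reasoning
    row : ∀ i j → (i * z + j * - r) * p + (i * - q + j * p) * r ≡ i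
    row i j = begin
      (i * z + j * - r) * p + (i * - q + j * p) * r ≡⟨ solve (i ∷ j ∷ p ∷ q ∷ r ∷ z ∷ []) ⟩
      (p * z - q * r) * i                           ≡⟨ cong (_* i) det≡1 ⟩
      1ℤ * i                                        ≡⟨ ℤP.*-identityˡ i ⟩
      i                                             ∎
    col : ∀ i j → (i * z + j * - r) * q + (i * - q + j * p) * z ≡ j
    col i j = begin
      (i * z + j * - r) * q + (i * - q + j * p) * z ≡⟨ solve (i ∷ j ∷ p ∷ q ∷ r ∷ z ∷ []) ⟩
      (p * z - q * r) * j                           ≡⟨ cong (_* j) det≡1 ⟩
      1ℤ * j                                        ≡⟨ ℤP.*-identityˡ j ⟩
      j                                             ∎

  conjugate⇒intertwines : ∀ γ X Y → det γ ≡ 1ℤ → (toℚ γ *ℚ toℚ X) *ℚ toℚ (adj γ) ≡ toℚ Y →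
                          γ *ℤ X ≡ Y *ℤ γ
  conjugate⇒intertwines γ X Y det≡1 eq = begin
    γ *ℤ X                          ≡⟨ *-adj-cancelʳ (γ *ℤ X) γ det≡1 ⟨
    ((γ *ℤ X) *ℤ adj γ) *ℤ γ        ≡⟨ cong (_*ℤ γ) γXγ⁻¹≡Y ⟩
    Y *ℤ γ                          ∎
    where
    open ≡-Reasoning
    γXγ⁻¹≡Y : (γ *ℤ X) *ℤ adj γ ≡ Y
    γXγ⁻¹≡Y = toℚ-injective (begin
      toℚ ((γ *ℤ X) *ℤ adj γ)           ≡⟨ toℚ-homo-* (γ *ℤ X) (adj γ) ⟩
      toℚ (γ *ℤ X) *ℚ toℚ (adj γ)       ≡⟨ cong (_*ℚ toℚ (adj γ)) (toℚ-homo-* γ X) ⟩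
      (toℚ γ *ℚ toℚ X) *ℚ toℚ (adj γ)   ≡⟨ eq ⟩
      toℚ Y                             ∎)

  toℚ-commute⇒commute : ∀ γ X → toℚ γ *ℚ toℚ X ≡ toℚ X *ℚ toℚ γ → γ *ℤ X ≡ X *ℤ γ
  toℚ-commute⇒commute γ X eq = toℚ-injective (trans (toℚ-homo-* γ X) (trans eq (sym (toℚ-homo-* X γ))))

  toℚ-idℤ-*ℚ : ∀ X → toℚ idℤ *ℚ X ≡ X
  toℚ-idℤ-*ℚ (mat a b c d) = mat-cong (unit a c) (unit b d) (unit′ a c) (unit′ b d)
    where
    unit : ∀ x y → 1ℚ ℚ.* x ℚ.+ 0ℚ ℚ.* y ≡ x
    unit = RingSolver.solve-∀ ℚ-ring
    unit′ : ∀ x y → 0ℚ ℚ.* x ℚ.+ 1ℚ ℚ.* y ≡ y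
    unit′ = RingSolver.solve-∀ ℚ-ring

  *ℚ-toℚ-idℤ : ∀ X → X *ℚ toℚ idℤ ≡ X
  *ℚ-toℚ-idℤ (mat a b c d) = mat-cong (unit a b) (unit′ a b) (unit c d) (unit′ c d)
    where
    unit : ∀ x y → x ℚ.* 1ℚ ℚ.+ y ℚ.* 0ℚ ≡ x
    unit = RingSolver.solve-∀ ℚ-ring
    unit′ : ∀ x y → x ℚ.* 0ℚ ℚ.+ y ℚ.* 1ℚ ≡ y
    unit′ = RingSolver.solve-∀ ℚ-ring

  Conj-refl : ∀ N X → Conj N X X
  Conj-refl N X = idℤ , (refl , N ℕD.∣0) , trans (cong (_*ℚ toℚ idℤ) (toℚ-idℤ-*ℚ X)) (*ℚ-toℚ-idℤ X)

  module _ (u w : ℕ) .{{_ : NonZero w}} where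

    private
      q = frac u w
      open ≡-Reasoning

      row-at-cusp : ∀ a b c → a * + u + b * + w ≡ c → (ℤtoℚ a ℚ.* q ℚ.+ ℤtoℚ b) ℚ.* ℕtoℚ w ≡ ℤtoℚ c
      row-at-cusp a b c eq = begin
        (ℤtoℚ a ℚ.* q ℚ.+ ℤtoℚ b) ℚ.* ℕtoℚ w           ≡⟨ distrib (ℤtoℚ a) q (ℤtoℚ b) (ℕtoℚ w) ⟩
        ℤtoℚ a ℚ.* (q ℚ.* ℕtoℚ w) ℚ.+ ℤtoℚ b ℚ.* ℕtoℚ w ≡⟨ cong (λ e → ℤtoℚ a ℚ.* e ℚ.+ ℤtoℚ b ℚ.* ℕtoℚ w) (frac-* u w) ⟩
        ℤtoℚ a ℚ.* ℕtoℚ u ℚ.+ ℤtoℚ b ℚ.* ℕtoℚ w         ≡⟨ ℤtoℚ-linear a (+ u) b (+ w) ⟨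
        ℤtoℚ (a * + u + b * + w)                        ≡⟨ cong ℤtoℚ eq ⟩
        ℤtoℚ c                                          ∎
        where
        distrib : ∀ x y z v → (x ℚ.* y ℚ.+ z) ℚ.* v ≡ x ℚ.* (y ℚ.* v) ℚ.+ z ℚ.* v
        distrib = RingSolver.solve-∀ ℚ-ring

    eigenvector⇒fixes : ∀ X k → X ⊙ (+ u , + w) ≡ k · (+ u , + w) → k ≢ 0ℤ → Fixes (toℚ X) (frac u w)
    eigenvector⇒fixes (mat x11 x12 x21 x22) k Xv≡kv k≢0 = denominator≢0 , numerator≡
      where
      denominator≡k : ℤtoℚ x21 ℚ.* q ℚ.+ ℤtoℚ x22 ≡ ℤtoℚ k
      denominator≡k = *-cancelʳ-ℕtoℚ w (trans (row-at-cusp x21 x22 (k * + w) (cong proj₂ Xv≡kv))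
                                              (ℤtoℚ-homo-* k (+ w)))
      denominator≢0 : ℤtoℚ x21 ℚ.* q ℚ.+ ℤtoℚ x22 ≢ 0ℚ
      denominator≢0 eq = k≢0 (ℤtoℚ-injective (trans (sym denominator≡k) eq))
      numerator≡ : ℤtoℚ x11 ℚ.* q ℚ.+ ℤtoℚ x12 ≡ q ℚ.* (ℤtoℚ x21 ℚ.* q ℚ.+ ℤtoℚ x22)
      numerator≡ = *-cancelʳ-ℕtoℚ w (begin
        (ℤtoℚ x11 ℚ.* q ℚ.+ ℤtoℚ x12) ℚ.* ℕtoℚ w       ≡⟨ row-at-cusp x11 x12 (k * + u) (cong proj₁ Xv≡kv) ⟩
        ℤtoℚ (k * + u)                                 ≡⟨ ℤtoℚ-homo-* k (+ u) ⟩
        ℤtoℚ k ℚ.* ℕtoℚ u                              ≡⟨ cong (ℤtoℚ k ℚ.*_) (frac-* u w) ⟨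
        ℤtoℚ k ℚ.* (q ℚ.* ℕtoℚ w)                      ≡⟨ rearrange (ℤtoℚ k) q (ℕtoℚ w) ⟩
        q ℚ.* ℤtoℚ k ℚ.* ℕtoℚ w                        ≡⟨ cong (λ e → q ℚ.* e ℚ.* ℕtoℚ w) denominator≡k ⟨
        q ℚ.* (ℤtoℚ x21 ℚ.* q ℚ.+ ℤtoℚ x22) ℚ.* ℕtoℚ w ∎)
        where
        rearrange : ∀ x y z → x ℚ.* (y ℚ.* z) ≡ y ℚ.* x ℚ.* z
        rearrange = RingSolver.solve-∀ ℚ-ring

module LineStabiliser (U W : ℤ) .{{_ : ℤ.NonZero U}} .{{_ : ℤ.NonZero W}} (U⊥W : Coprime U W) where

  open import Data.Integer using (_+_; _*_; _-_; -_)
  open Arithmetic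
  open Matrices

  OnLine : Vec2 → Set
  OnLine (x , y) = W * x ≡ U * y

  -- ε·1 + β·(U , W)ᵀ(W , −U)
  stabiliser : ℤ → ℤ → Mat ℤ
  stabiliser ε β = mat (ε + β * U * W) (- (β * U * U)) (β * W * W) (ε - β * U * W)

  private
    W⊥U : Coprime W U
    W⊥U = ℤC.sym {U} {W} U⊥W

    instance
      UW≢0 : ℤ.NonZero (U * W)
      UW≢0 = ℤP.i*j≢0 U W

    open ≡-Reasoning

    line-equation : ∀ p α β′ z → OnLine (mat p (α * U) (β′ * W) z ⊙ (U , W)) →
                    p + α * W ≡ β′ * U + z
    line-equation p α β′ z online = ℤP.*-cancelʳ-≡ _ _ (U * W) (begin
      (p + α * W) * (U * W)       ≡⟨ solve (p ∷ α ∷ U ∷ W ∷ []) ⟩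
      W * (p * U + α * U * W)     ≡⟨ online ⟩
      U * (β′ * W * U + z * W)    ≡⟨ solve (β′ ∷ z ∷ U ∷ W ∷ []) ⟩
      (β′ * U + z) * (U * W)      ∎)

    diagonal-unit : ∀ p α β′ z → p * z - α * U * (β′ * W) ≡ 1ℤ → p + α * W ≡ β′ * U + z →
                    (p + α * W) * (z - α * W) ≡ 1ℤ
    diagonal-unit p α β′ z det≡1 ρ = begin
      (p + α * W) * (z - α * W)
        ≡⟨ solve (p ∷ α ∷ β′ ∷ z ∷ U ∷ W ∷ []) ⟩
      p * z - α * U * (β′ * W) + α * W * ((β′ * U + z) - (p + α * W))
        ≡⟨ cong (λ e → p * z - α * U * (β′ * W) + α * W * (e - (p + α * W))) ρ ⟨
      p * z - α * U * (β′ * W) + α * W * ((p + α * W) - (p + α * W))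
        ≡⟨ solve (p ∷ α ∷ β′ ∷ z ∷ U ∷ W ∷ []) ⟩
      p * z - α * U * (β′ * W)
        ≡⟨ det≡1 ⟩
      1ℤ ∎

    off-diagonal : ∀ p α β′ z → p + α * W ≡ β′ * U + z → z - α * W ≡ p + α * W →
                   U * β′ ≡ - α * W
    off-diagonal p α β′ z ρ z-αW≡ε = begin
      U * β′                 ≡⟨ solve (β′ ∷ z ∷ U ∷ []) ⟩
      (β′ * U + z) - z       ≡⟨ cong (_- z) ρ ⟨
      (p + α * W) - z        ≡⟨ cong (_- z) z-αW≡ε ⟨
      (z - α * W) - z        ≡⟨ solve (z ∷ α ∷ W ∷ []) ⟩
      - α * W                ∎

    off-diagonal-quotient : ∀ α β → U * (β * W) ≡ - α * W → α ≡ - (β * U)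
    off-diagonal-quotient α β eq = ℤP.*-cancelʳ-≡ α (- (β * U)) W (begin
      α * W                  ≡⟨ solve (α ∷ W ∷ []) ⟩
      - (- α * W)            ≡⟨ cong -_ eq ⟨
      - (U * (β * W))        ≡⟨ solve (β ∷ U ∷ W ∷ []) ⟩
      - (β * U) * W          ∎)

    stabiliser-entries : ∀ p α β z → α ≡ - (β * U) → z - α * W ≡ p + α * W →
               mat p (α * U) (β * W * W) z ≡ stabiliser (p + α * W) β
    stabiliser-entries p α β z α≡-βU z-αW≡ε = mat-cong
      (begin
        p                              ≡⟨ solve (p ∷ α ∷ W ∷ []) ⟩
        p + α * W - α * W              ≡⟨ cong (λ e → p + α * W - e * W) α≡-βU ⟩
        p + α * W - - (β * U) * W      ≡⟨ solve (p ∷ α ∷ β ∷ U ∷ W ∷ []) ⟩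
        p + α * W + β * U * W          ∎)
      (begin
        α * U                          ≡⟨ cong (_* U) α≡-βU ⟩
        - (β * U) * U                  ≡⟨ solve (β ∷ U ∷ []) ⟩
        - (β * U * U)                  ∎)
      refl
      (begin
        z                              ≡⟨ solve (z ∷ α ∷ W ∷ []) ⟩
        z - α * W + α * W              ≡⟨ cong (_+ α * W) z-αW≡ε ⟩
        p + α * W + α * W              ≡⟨ cong (λ e → p + α * W + e * W) α≡-βU ⟩
        p + α * W + - (β * U) * W      ≡⟨ solve (p ∷ α ∷ β ∷ U ∷ W ∷ []) ⟩
        p + α * W - β * U * W          ∎)

    divisor⇒stabiliser : ∀ p α β′ z → p + α * W ≡ β′ * U + z →
                         IsSign (p + α * W) × z - α * W ≡ p + α * W → W ∣ˢ β′ →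
                         Σ ℤ λ ε → Σ ℤ λ β → IsSign ε × mat p (α * U) (β′ * W) z ≡ stabiliser ε β
    divisor⇒stabiliser p α _ z ρ (ε-sign , z-αW≡ε) (divides β refl) =
      p + α * W , β , ε-sign ,
      stabiliser-entries p α β z (off-diagonal-quotient α β (off-diagonal p α (β * W) z ρ z-αW≡ε)) z-αW≡ε

    stabiliser-form : ∀ p α β′ z → p * z - α * U * (β′ * W) ≡ 1ℤ →
                      OnLine (mat p (α * U) (β′ * W) z ⊙ (U , W)) →
                      Σ ℤ λ ε → Σ ℤ λ β → IsSign ε × mat p (α * U) (β′ * W) z ≡ stabiliser ε β
    stabiliser-form p α β′ z det≡1 online = divisor⇒stabiliser p α β′ z ρ unit
      (coprime-divisorˢ W U β′ W⊥U (divides (- α) (off-diagonal p α β′ z ρ (proj₂ unit))))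
      where
      ρ : p + α * W ≡ β′ * U + z
      ρ = line-equation p α β′ z online
      unit : IsSign (p + α * W) × z - α * W ≡ p + α * W
      unit = i*j≡1⇒±1 (p + α * W) (z - α * W) (diagonal-unit p α β′ z det≡1 ρ)

    U∣upper-right : ∀ p q r z → OnLine (mat p q r z ⊙ (U , W)) → U ∣ˢ q
    U∣upper-right p q r z online =
      coprime-divisorˢ U W q U⊥W (coprime-divisorˢ U W (W * q) U⊥W (divides (r * U + z * W - p * W) (begin
        W * (W * q)                      ≡⟨ solve (p ∷ q ∷ U ∷ W ∷ []) ⟩
        W * (p * U + q * W) - p * U * W  ≡⟨ cong (_- p * U * W) online ⟩
        U * (r * U + z * W) - p * U * W  ≡⟨ solve (p ∷ r ∷ z ∷ U ∷ W ∷ []) ⟩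
        (r * U + z * W - p * W) * U      ∎)))

    W∣lower-left : ∀ p q r z → OnLine (mat p q r z ⊙ (U , W)) → W ∣ˢ r
    W∣lower-left p q r z online =
      coprime-divisorˢ W U r W⊥U (coprime-divisorˢ W U (U * r) W⊥U (divides (p * U + q * W - z * U) (begin
        U * (U * r)                      ≡⟨ solve (r ∷ z ∷ U ∷ W ∷ []) ⟩
        U * (r * U + z * W) - z * W * U  ≡⟨ cong (_- z * W * U) online ⟨
        W * (p * U + q * W) - z * W * U  ≡⟨ solve (p ∷ q ∷ z ∷ U ∷ W ∷ []) ⟩
        (p * U + q * W - z * U) * W      ∎)))

    divisors⇒stabiliser : ∀ p q r z → U ∣ˢ q → W ∣ˢ r → p * z - q * r ≡ 1ℤ →
                          OnLine (mat p q r z ⊙ (U , W)) →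
                          Σ ℤ λ ε → Σ ℤ λ β → IsSign ε × mat p q r z ≡ stabiliser ε β
    divisors⇒stabiliser p _ _ z (divides α refl) (divides β′ refl) = stabiliser-form p α β′ z

  line-preserving⇒stabiliser : ∀ γ → det γ ≡ 1ℤ → OnLine (γ ⊙ (U , W)) →
                               Σ ℤ λ ε → Σ ℤ λ β → IsSign ε × γ ≡ stabiliser ε β
  line-preserving⇒stabiliser (mat p q r z) det≡1 online =
    divisors⇒stabiliser p q r z (U∣upper-right p q r z online) (W∣lower-left p q r z online) det≡1 online

module HermiteDecomposition where

  open import Data.Integer using (_+_; _*_; _-_; -_)
  open Arithmetic
  open Matrices using (mat-cong)
  open ≡-Reasoning

  triangular-factor : ∀ x11 x12 P Q p r g b k d →
    P * p + Q * r ≡ 1ℤ → x11 * r - x12 * p ≡ d → - (x11 * P + x12 * Q) ≡ + b + k * d →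
    mat x11 x12 (p * g) (r * g) ≡ mat d (- + b) 0ℤ g *ℤ mat (Q - k * p) (- P - k * r) p r
  triangular-factor x11 x12 P Q p r g b k d bz x11r-x12p≡d -B≡b+kd = mat-cong
    (begin
      x11                                                  ≡⟨ ℤP.*-identityʳ x11 ⟨
      x11 * 1ℤ                                             ≡⟨ cong (x11 *_) bz ⟨
      x11 * (P * p + Q * r)                                ≡⟨ solve (x11 ∷ x12 ∷ P ∷ Q ∷ p ∷ r ∷ []) ⟩
      (x11 * r - x12 * p) * Q - - (x11 * P + x12 * Q) * p  ≡⟨ cong₂ (λ e f → e * Q - f * p) x11r-x12p≡d -B≡b+kd ⟩
      d * Q - (+ b + k * d) * p                            ≡⟨ collect d Q (+ b) k p ⟩
      d * (Q - k * p) + - + b * p                          ∎)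
    (begin
      x12                                                  ≡⟨ ℤP.*-identityʳ x12 ⟨
      x12 * 1ℤ                                             ≡⟨ cong (x12 *_) bz ⟨
      x12 * (P * p + Q * r)                                ≡⟨ solve (x11 ∷ x12 ∷ P ∷ Q ∷ p ∷ r ∷ []) ⟩
      (x11 * r - x12 * p) * - P - - (x11 * P + x12 * Q) * r ≡⟨ cong₂ (λ e f → e * - P - f * r) x11r-x12p≡d -B≡b+kd ⟩
      d * - P - (+ b + k * d) * r                          ≡⟨ collect d (- P) (+ b) k r ⟩
      d * (- P - k * r) + - + b * r                        ∎)
    (bottom p (Q - k * p))
    (bottom r (- P - k * r))
    where
    bottom : ∀ x y → x * g ≡ 0ℤ * y + g * x
    bottom x y = solve (x ∷ y ∷ g ∷ [])
    collect : ∀ d Q b k p → d * Q - (b + k * d) * p ≡ d * (Q - k * p) + - b * p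
    collect d Q b k p = solve (d ∷ Q ∷ b ∷ k ∷ p ∷ [])

  private
    det-scaled : ∀ x11 x12 p r G → x11 * (r * G) - x12 * (p * G) ≡ (x11 * r - x12 * p) * G
    det-scaled x11 x12 p r G = solve (x11 ∷ x12 ∷ p ∷ r ∷ G ∷ [])

    bézout-scaled : ∀ P Q p r G → P * (p * G) + Q * (r * G) ≡ (P * p + Q * r) * G
    bézout-scaled P Q p r G = solve (P ∷ Q ∷ p ∷ r ∷ G ∷ [])

    det-shear : ∀ P Q p r k → (Q - k * p) * r - (- P - k * r) * p ≡ P * p + Q * r
    det-shear P Q p r k = solve (P ∷ Q ∷ p ∷ r ∷ k ∷ [])

    -- a′ is the gcd g of the bottom row, whose quotient (p , r) is the bottom row of γ;
    -- b′ is −B reduced modulo d′.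
    hermite-factor : ∀ N n₀ → gcd (suc n₀) N ≡ 1 → ∀ x11 x12 P Q p r g₀ d₀ →
      P * (p * + suc g₀) + Q * (r * + suc g₀) ≡ + suc g₀ → x11 * r - x12 * p ≡ + suc d₀ →
      det (mat x11 x12 (p * + suc g₀) (r * + suc g₀)) ≡ + suc n₀ → (+ N) ℤD.∣ p * + suc g₀ →
      InΓstar N (suc n₀) (toℚ (mat x11 x12 (p * + suc g₀) (r * + suc g₀)))
    hermite-factor N n₀ gcd≡1 x11 x12 P Q p r g₀ d₀ bz₀ x11r-x12p≡d det≡n N∣pg =
      g , d , b , γ , gd≡n , ℕ.s≤s ℕ.z≤n , ℕ.s≤s ℕ.z≤n , n%ℕd<d (- B) d , (det-γ , N∣p) ,
      cong toℚ (triangular-factor x11 x12 P Q p r (+ g) b k (+ d) bz x11r-x12p≡d (a≡a%ℕn+[a/ℕn]*n (- B) d))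
      where
      g d : ℕ
      g = suc g₀
      d = suc d₀
      B : ℤ
      B = x11 * P + x12 * Q
      b : ℕ
      b = (- B) %ℕ d
      k : ℤ
      k = (- B) /ℕ d
      γ : Mat ℤ
      γ = mat (Q - k * p) (- P - k * r) p r
      bz : P * p + Q * r ≡ 1ℤ
      bz = ℤP.*-cancelʳ-≡ _ _ (+ g) (trans (sym (bézout-scaled P Q p r (+ g))) (trans bz₀ (sym (ℤP.*-identityˡ (+ g)))))
      det-γ : det γ ≡ + 1
      det-γ = trans (det-shear P Q p r k) bz
      gd≡n : g ℕ.* d ≡ suc n₀
      gd≡n = ℤP.+-injective (begin
        + (g ℕ.* d)                  ≡⟨ ℤP.pos-* g d ⟩
        + g * + d                    ≡⟨ ℤP.*-comm (+ g) (+ d) ⟩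
        + d * + g                    ≡⟨ cong (_* + g) x11r-x12p≡d ⟨
        (x11 * r - x12 * p) * + g    ≡⟨ det-scaled x11 x12 p r (+ g) ⟨
        det (mat x11 x12 (p * + g) (r * + g)) ≡⟨ det≡n ⟩
        + suc n₀                     ∎)
      N∣p : (+ N) ℤD.∣ p
      N∣p = ℤC.coprime-divisor (+ N) (+ g) p
              (coprime-to-divisor gcd≡1 (ℕD.divides d (trans (sym gd≡n) (ℕP.*-comm g d))))
              (subst ((+ N) ℤD.∣_) (ℤP.*-comm p (+ g)) N∣pg)

  hermite-decomposition : ∀ N n .{{_ : NonZero n}} → gcd n N ≡ 1 → ∀ x → det x ≡ + n → (+ N) ℤD.∣ e21 x →
            InΓstar N n (toℚ x)
  hermite-decomposition N (suc n₀) gcd≡1 (mat x11 x12 x21 x22) det≡n N∣x21 = factor (bézout x21 x22) g∣x21 g∣x22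
    where
    g : ℕ
    g = gcd ℤ.∣ x21 ∣ ℤ.∣ x22 ∣
    g∣x21 : (+ g) ∣ˢ x21
    g∣x21 = ∣ᵤ⇒∣ {+ g} {x21} (gcd[m,n]∣m ℤ.∣ x21 ∣ ℤ.∣ x22 ∣)
    g∣x22 : (+ g) ∣ˢ x22
    g∣x22 = ∣ᵤ⇒∣ {+ g} {x22} (gcd[m,n]∣n ℤ.∣ x21 ∣ ℤ.∣ x22 ∣)
    factor : ∀ {h} → (Σ ℤ λ P → Σ ℤ λ Q → P * x21 + Q * x22 ≡ + h) → (+ h) ∣ˢ x21 → (+ h) ∣ˢ x22 →
             InΓstar N (suc n₀) (toℚ (mat x11 x12 x21 x22))
    factor {suc g₀} (P , Q , bz) (divides p refl) (divides r refl) =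
      hermite-factor N n₀ gcd≡1 x11 x12 P Q p r g₀ (proj₁ d>0) bz (proj₂ d>0) det≡n N∣x21
      where
      d>0 : Σ ℕ λ d₀ → x11 * r - x12 * p ≡ + suc d₀
      d>0 = positive-factor (x11 * r - x12 * p) g₀ n₀ (trans (sym (det-scaled x11 x12 p r (+ suc g₀))) det≡n)
    factor {zero} _ (divides p refl) (divides r refl) = ⊥-elim (0≢1+n (begin
      + 0                                   ≡⟨ ℤP.*-zeroʳ (x11 * r - x12 * p) ⟨
      (x11 * r - x12 * p) * + 0             ≡⟨ det-scaled x11 x12 p r (+ 0) ⟨
      x11 * (r * + 0) - x12 * (p * + 0)     ≡⟨ det≡n ⟩
      + suc n₀                              ∎))
      where
      0≢1+n : + 0 ≢ + suc n₀
      0≢1+n ()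

module CuspMatrices (A D U W : ℤ) where

  open import Data.Integer using (_+_; _*_; _-_; -_)
  open Arithmetic
  open Matrices

  record Integral (t : ℤ) : Set where
    constructor integral
    field
      s m      : ℤ
      t≡sW     : t ≡ s * W
      A-D-t≡mU : A - D - t ≡ m * U

  -- With A, D, U, W = a, d, u, w and t = b·L, X[ ι ] is √n·P (see Pmat-integral).
  X[_] : ∀ {t} → Integral t → Mat ℤ
  X[_] {t} (integral s m _ _) = mat (A - t) (s * U) (m * W) (D + t)

  open ≡-Reasoning

  X-eigenvector : ∀ {t} (ι : Integral t) → X[ ι ] ⊙ (U , W) ≡ A · (U , W)
  X-eigenvector (integral s m refl A-D-t≡mU) = cong₂ _,_
    (begin
      (A - s * W) * U + s * U * W        ≡⟨ solve (A ∷ s ∷ U ∷ W ∷ []) ⟩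
      A * U                              ∎)
    (begin
      m * W * U + (D + s * W) * W        ≡⟨ solve (m ∷ D ∷ s ∷ U ∷ W ∷ []) ⟩
      (m * U + D + s * W) * W            ≡⟨ cong (λ e → (e + D + s * W) * W) A-D-t≡mU ⟨
      (A - D - s * W + D + s * W) * W    ≡⟨ solve (A ∷ D ∷ s ∷ W ∷ []) ⟩
      A * W                              ∎)

  det-X : ∀ {t} (ι : Integral t) → det X[ ι ] ≡ A * D
  det-X (integral s m refl A-D-t≡mU) = begin
    (A - s * W) * (D + s * W) - s * U * (m * W)
      ≡⟨ solve (A ∷ D ∷ s ∷ m ∷ U ∷ W ∷ []) ⟩
    A * D + s * W * ((A - D - s * W) - m * U)
      ≡⟨ cong (λ e → A * D + s * W * (e - m * U)) A-D-t≡mU ⟩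
    A * D + s * W * (m * U - m * U)
      ≡⟨ solve (A ∷ D ∷ s ∷ m ∷ U ∷ W ∷ []) ⟩
    A * D ∎

  module Admissibility (N K : ℤ) where

    Admissible : ℤ → Set
    Admissible t = Σ (Integral t) λ ι → N ∣ˢ e21 X[ ι ]

    admissible-shift : N ∣ˢ K * (W * W) → ∀ {t} → Admissible t → ∀ e → Admissible (t + e * (U * K * W))
    admissible-shift N∣KW² (integral s m refl A-D-t≡mU , N∣mW) e =
      integral (s + e * U * K) (m - e * K * W) (solve (s ∷ e ∷ U ∷ K ∷ W ∷ [])) A-D-t′≡m′U , N∣m′W
      where
      A-D-t′≡m′U : A - D - (s * W + e * (U * K * W)) ≡ (m - e * K * W) * U
      A-D-t′≡m′U = begin
        A - D - (s * W + e * (U * K * W))    ≡⟨ solve (A ∷ D ∷ s ∷ e ∷ U ∷ K ∷ W ∷ []) ⟩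
        (A - D - s * W) - e * K * W * U      ≡⟨ cong (_- e * K * W * U) A-D-t≡mU ⟩
        m * U - e * K * W * U                ≡⟨ solve (m ∷ e ∷ U ∷ K ∷ W ∷ []) ⟩
        (m - e * K * W) * U                  ∎
      N∣m′W : N ∣ˢ (m - e * K * W) * W
      N∣m′W = subst (N ∣ˢ_) rearrange (∣m∣n⇒∣m-n N∣mW (∣n⇒∣m*n e N∣KW²))
        where
        rearrange : m * W - e * (K * (W * W)) ≡ (m - e * K * W) * W
        rearrange = solve (m ∷ e ∷ K ∷ W ∷ [])

    admissible-congruent : .{{_ : ℤ.NonZero U}} → Coprime U W → (∀ σ → N ∣ˢ σ * (W * W) → K ∣ˢ σ) →
                           ∀ {t t′} → Admissible t → Admissible t′ → Σ ℤ λ e → t - t′ ≡ e * (U * K * W)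
    admissible-congruent U⊥W K-index (integral s m refl A-D-t≡mU , N∣mW) (integral s′ m′ refl A-D-t′≡m′U , N∣m′W) =
      via-σ (coprime-divisorˢ U W (s - s′) U⊥W (divides (m′ - m) W[s-s′]≡[m′-m]U))
      where
      W[s-s′]≡[m′-m]U : W * (s - s′) ≡ (m′ - m) * U
      W[s-s′]≡[m′-m]U = begin
        W * (s - s′)                              ≡⟨ solve (A ∷ D ∷ s ∷ s′ ∷ W ∷ []) ⟩
        (A - D - s′ * W) - (A - D - s * W)        ≡⟨ cong₂ _-_ A-D-t′≡m′U A-D-t≡mU ⟩
        m′ * U - m * U                            ≡⟨ solve (m ∷ m′ ∷ U ∷ []) ⟩
        (m′ - m) * U                              ∎
      via-σ : U ∣ˢ (s - s′) → Σ ℤ λ e → s * W - s′ * W ≡ e * (U * K * W)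
      via-σ (divides σ s-s′≡σU) = via-e (K-index σ N∣σW²)
        where
        m′-m≡σW : m′ - m ≡ σ * W
        m′-m≡σW = ℤP.*-cancelʳ-≡ (m′ - m) (σ * W) U (begin
          (m′ - m) * U        ≡⟨ W[s-s′]≡[m′-m]U ⟨
          W * (s - s′)        ≡⟨ cong (W *_) s-s′≡σU ⟩
          W * (σ * U)         ≡⟨ solve (σ ∷ U ∷ W ∷ []) ⟩
          σ * W * U           ∎)
        N∣σW² : N ∣ˢ σ * (W * W)
        N∣σW² = subst (N ∣ˢ_) (begin
          m′ * W - m * W      ≡⟨ solve (m ∷ m′ ∷ W ∷ []) ⟩
          (m′ - m) * W        ≡⟨ cong (_* W) m′-m≡σW ⟩
          σ * W * W           ≡⟨ solve (σ ∷ W ∷ []) ⟩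
          σ * (W * W)         ∎) (∣m∣n⇒∣m-n N∣m′W N∣mW)
        via-e : K ∣ˢ σ → Σ ℤ λ e → s * W - s′ * W ≡ e * (U * K * W)
        via-e (divides e σ≡eK) = e , (begin
          s * W - s′ * W      ≡⟨ solve (s ∷ s′ ∷ W ∷ []) ⟩
          (s - s′) * W        ≡⟨ cong (_* W) s-s′≡σU ⟩
          σ * U * W           ≡⟨ cong (λ x → x * U * W) σ≡eK ⟩
          e * K * U * W       ≡⟨ solve (e ∷ U ∷ K ∷ W ∷ []) ⟩
          e * (U * K * W)     ∎)

    admissible-from-bézout : ∀ Nw P Q h → N ≡ Nw * W → A - D ≡ h * (P * W + Q * (U * Nw)) →
                             Admissible (P * W * h)
    admissible-from-bézout Nw P Q h N≡NwW A-D≡ =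
      integral (P * h) (Q * Nw * h) (solve (P ∷ W ∷ h ∷ [])) (begin
        A - D - P * W * h                              ≡⟨ cong (_- P * W * h) A-D≡ ⟩
        h * (P * W + Q * (U * Nw)) - P * W * h         ≡⟨ solve (P ∷ Q ∷ U ∷ W ∷ Nw ∷ h ∷ []) ⟩
        Q * Nw * h * U                                 ∎) ,
      divides (Q * h) (begin
        Q * Nw * h * W       ≡⟨ solve (Q ∷ Nw ∷ h ∷ W ∷ []) ⟩
        Q * h * (Nw * W)     ≡⟨ cong (Q * h *_) N≡NwW ⟨
        Q * h * N            ∎)

  module _ (A≢D : A ≢ D) where

    private instance
      A-D≢0 : ℤ.NonZero (A - D)
      A-D≢0 = ℤ.≢-nonZero (λ A-D≡0 → A≢D (ℤP.i-j≡0⇒i≡j A D A-D≡0))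

    -- Since A − D = s·W + m·U, the two rows of X[ ι ] (x , y) = A (x , y) combine to
    -- (A − D)(U y − W x) = 0.
    X-eigenline : ∀ {t} (ι : Integral t) {x y} → X[ ι ] ⊙ (x , y) ≡ A · (x , y) → W * x ≡ U * y
    X-eigenline (integral s m refl A-D-t≡mU) {x} {y} Xv≡Av =
      sym (ℤP.i-j≡0⇒i≡j (U * y) (W * x) (ℤP.*-cancelˡ-≡ (A - D) (U * y - W * x) 0ℤ (begin
        (A - D) * (U * y - W * x)
          ≡⟨ solve (A ∷ D ∷ s ∷ m ∷ U ∷ W ∷ x ∷ y ∷ []) ⟩
        W * ((A - s * W) * x + s * U * y) - W * (A * x) - U * (m * W * x + (D + s * W) * y) + U * (A * y)
          + (m * U - (A - D - s * W)) * W * x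
          ≡⟨ cong₂ (λ e f → W * e - W * (A * x) - U * f + U * (A * y) + (m * U - (A - D - s * W)) * W * x)
                   (cong proj₁ Xv≡Av) (cong proj₂ Xv≡Av) ⟩
        W * (A * x) - W * (A * x) - U * (A * y) + U * (A * y) + (m * U - (A - D - s * W)) * W * x
          ≡⟨ cong (λ e → W * (A * x) - W * (A * x) - U * (A * y) + U * (A * y) + (m * U - e) * W * x) A-D-t≡mU ⟩
        W * (A * x) - W * (A * x) - U * (A * y) + U * (A * y) + (m * U - m * U) * W * x
          ≡⟨ solve (A ∷ D ∷ m ∷ U ∷ W ∷ x ∷ y ∷ []) ⟩
        (A - D) * 0ℤ ∎)))

    module _ .{{_ : ℤ.NonZero U}} .{{_ : ℤ.NonZero W}} (U⊥W : Coprime U W) where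
      open LineStabiliser U W U⊥W public using (stabiliser)
      open LineStabiliser U W U⊥W using (line-preserving⇒stabiliser)

      stabiliser-shift : ∀ {t t′} (ι : Integral t) (ι′ : Integral t′) ε β →
                         e11 (stabiliser ε β *ℤ X[ ι ]) ≡ e11 (X[ ι′ ] *ℤ stabiliser ε β) →
                         ε * (t′ - t) ≡ β * U * W * (A - D)
      stabiliser-shift (integral s m refl A-D-t≡mU) (integral s′ m′ refl _) ε β eq = begin
        ε * (s′ * W - s * W)
          ≡⟨ solve (A ∷ s ∷ s′ ∷ m ∷ ε ∷ β ∷ U ∷ W ∷ []) ⟩
        ((ε + β * U * W) * (A - s * W) + - (β * U * U) * (m * W))
          - ((A - s′ * W) * (ε + β * U * W) + s′ * U * (β * W * W))
          + β * U * W * (s * W + m * U)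
          ≡⟨ cong₂ (λ e f → e + β * U * W * (s * W + f)) (ℤP.i≡j⇒i-j≡0 eq) (sym A-D-t≡mU) ⟩
        0ℤ + β * U * W * (s * W + (A - D - s * W))
          ≡⟨ solve (A ∷ D ∷ s ∷ β ∷ U ∷ W ∷ []) ⟩
        β * U * W * (A - D) ∎

      intertwiner-form : ∀ {t t′} (ι : Integral t) (ι′ : Integral t′) γ → det γ ≡ 1ℤ →
                         γ *ℤ X[ ι ] ≡ X[ ι′ ] *ℤ γ →
                         Σ ℤ λ ε → Σ ℤ λ β → IsSign ε × γ ≡ stabiliser ε β × ε * (t′ - t) ≡ β * U * W * (A - D)
      intertwiner-form {t} {t′} ι ι′ γ det≡1 γX≡X′γ = with-shift (line-preserving⇒stabiliser γ det≡1
        (X-eigenline ι′ (intertwine-eigenvector {γ} {X[ ι ]} {X[ ι′ ]} {A} {U , W} γX≡X′γ (X-eigenvector ι))))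
        where
        with-shift : (Σ ℤ λ ε → Σ ℤ λ β → IsSign ε × γ ≡ stabiliser ε β) →
                     Σ ℤ λ ε → Σ ℤ λ β → IsSign ε × γ ≡ stabiliser ε β × ε * (t′ - t) ≡ β * U * W * (A - D)
        with-shift (ε , β , ε-sign , γ≡stab) = ε , β , ε-sign , γ≡stab ,
          stabiliser-shift ι ι′ ε β (subst (λ g → e11 (g *ℤ X[ ι ]) ≡ e11 (X[ ι′ ] *ℤ g)) γ≡stab (cong e11 γX≡X′γ))

      private
        scalar-stabiliser : ∀ {ε} → IsSign ε → stabiliser ε 0ℤ ≡ idℤ ⊎ stabiliser ε 0ℤ ≡ negIdℤ
        scalar-stabiliser (inj₁ refl) = inj₁ refl
        scalar-stabiliser (inj₂ refl) = inj₂ refl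

      centraliser-trivial : ∀ {t} (ι : Integral t) γ → det γ ≡ 1ℤ → γ *ℤ X[ ι ] ≡ X[ ι ] *ℤ γ →
                            γ ≡ idℤ ⊎ γ ≡ negIdℤ
      centraliser-trivial {t} ι γ det≡1 γX≡Xγ = scalar (intertwiner-form ι ι γ det≡1 γX≡Xγ)
        where
        instance
          UW[A-D]≢0 : ℤ.NonZero (U * W * (A - D))
          UW[A-D]≢0 = ℤP.i*j≢0 (U * W) (A - D) {{ℤP.i*j≢0 U W}}
        β≡0 : ∀ ε β → ε * (t - t) ≡ β * U * W * (A - D) → β ≡ 0ℤ
        β≡0 ε β shift = ℤP.*-cancelʳ-≡ β 0ℤ (U * W * (A - D)) (begin
          β * (U * W * (A - D))  ≡⟨ solve (A ∷ D ∷ β ∷ U ∷ W ∷ []) ⟩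
          β * U * W * (A - D)    ≡⟨ shift ⟨
          ε * (t - t)            ≡⟨ solve (ε ∷ t ∷ []) ⟩
          0ℤ                     ∎)
        scalar : (Σ ℤ λ ε → Σ ℤ λ β → IsSign ε × γ ≡ stabiliser ε β × ε * (t - t) ≡ β * U * W * (A - D)) →
                 γ ≡ idℤ ⊎ γ ≡ negIdℤ
        scalar (ε , β , ε-sign , γ≡stab , shift) =
          subst (λ g → g ≡ idℤ ⊎ g ≡ negIdℤ) (sym (trans γ≡stab (cong (stabiliser ε) (β≡0 ε β shift))))
                (scalar-stabiliser ε-sign)

module ConjugatedTriangular (N u w a d K : ℕ) .{{u≢0 : NonZero u}} .{{w≢0 : NonZero w}} .{{K≢0 : NonZero K}}
                            (lcm≡Kw² : lcm (w ℕ.* w) N ≡ K ℕ.* (w ℕ.* w)) where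

  open import Data.Integer using (_+_; _*_; _-_; -_)
  open RationalEmbedding
  open Arithmetic
  open Matrices
  open ≡-Reasoning

  -- M = lcm(w², N) is the M of σ_𝔞, and L = u·M/w.
  M L : ℕ
  M = K ℕ.* (w ℕ.* w)
  L = u ℕ.* (K ℕ.* w)

  c c′ : ℚ
  c  = frac u w
  c′ = frac w u

  private
    M≢0 : NonZero M
    M≢0 = ℕP.m*n≢0 K (w ℕ.* w) {{K≢0}} {{ℕP.m*n≢0 w w}}
    uM≢0 : NonZero (u ℕ.* M)
    uM≢0 = ℕP.m*n≢0 u M {{u≢0}} {{M≢0}}

    Lw≡uM : L ℕ.* w ≡ u ℕ.* M
    Lw≡uM = rearrange u K w
      where
      rearrange : ∀ u K w → u ℕ.* (K ℕ.* w) ℕ.* w ≡ u ℕ.* (K ℕ.* (w ℕ.* w))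
      rearrange = ℕSolver.solve-∀

    M≡w*Kw : M ≡ w ℕ.* (K ℕ.* w)
    M≡w*Kw = rearrange K w
      where
      rearrange : ∀ K w → K ℕ.* (w ℕ.* w) ≡ w ℕ.* (K ℕ.* w)
      rearrange = ℕSolver.solve-∀

    cc′≡1 : c ℚ.* c′ ≡ 1ℚ
    cc′≡1 = *-cancelʳ-ℕtoℚ u (begin
      c ℚ.* c′ ℚ.* ℕtoℚ u      ≡⟨ ℚP.*-assoc c c′ (ℕtoℚ u) ⟩
      c ℚ.* (c′ ℚ.* ℕtoℚ u)    ≡⟨ cong (c ℚ.*_) (frac-* w u) ⟩
      c ℚ.* ℕtoℚ w             ≡⟨ frac-* u w ⟩
      ℕtoℚ u                   ≡⟨ ℚP.*-identityˡ (ℕtoℚ u) ⟨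
      1ℚ ℚ.* ℕtoℚ u            ∎)

    cM≡L : c ℚ.* ℕtoℚ M ≡ ℕtoℚ L
    cM≡L = begin
      c ℚ.* ℕtoℚ M                        ≡⟨ cong (λ e → c ℚ.* ℕtoℚ e) M≡w*Kw ⟩
      c ℚ.* ℕtoℚ (w ℕ.* (K ℕ.* w))        ≡⟨ cong (c ℚ.*_) (ℕtoℚ-homo-* w (K ℕ.* w)) ⟩
      c ℚ.* (ℕtoℚ w ℚ.* ℕtoℚ (K ℕ.* w))   ≡⟨ ℚP.*-assoc c (ℕtoℚ w) _ ⟨
      c ℚ.* ℕtoℚ w ℚ.* ℕtoℚ (K ℕ.* w)     ≡⟨ cong (ℚ._* ℕtoℚ (K ℕ.* w)) (frac-* u w) ⟩
      ℕtoℚ u ℚ.* ℕtoℚ (K ℕ.* w)           ≡⟨ ℕtoℚ-homo-* u (K ℕ.* w) ⟨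
      ℕtoℚ L                              ∎

    uM/w≡L : frac (u ℕ.* M) w ≡ ℕtoℚ L
    uM/w≡L = frac-unique (u ℕ.* M) w (trans (sym (ℕtoℚ-homo-* L w)) (cong ℕtoℚ Lw≡uM))

    w/uM*M≡c′ : frac w (u ℕ.* M) ℚ.* ℕtoℚ M ≡ c′
    w/uM*M≡c′ = *-cancelʳ-ℕtoℚ u (begin
      frac w (u ℕ.* M) ℚ.* ℕtoℚ M ℚ.* ℕtoℚ u     ≡⟨ ℚP.*-assoc (frac w (u ℕ.* M)) (ℕtoℚ M) (ℕtoℚ u) ⟩
      frac w (u ℕ.* M) ℚ.* (ℕtoℚ M ℚ.* ℕtoℚ u)   ≡⟨ cong (frac w (u ℕ.* M) ℚ.*_) (ℚP.*-comm (ℕtoℚ M) (ℕtoℚ u)) ⟩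
      frac w (u ℕ.* M) ℚ.* (ℕtoℚ u ℚ.* ℕtoℚ M)   ≡⟨ cong (frac w (u ℕ.* M) ℚ.*_) (ℕtoℚ-homo-* u M) ⟨
      frac w (u ℕ.* M) ℚ.* ℕtoℚ (u ℕ.* M)        ≡⟨ frac-* w (u ℕ.* M) {{uM≢0}} ⟩
      ℕtoℚ w                                     ≡⟨ frac-* w u ⟨
      c′ ℚ.* ℕtoℚ u                              ∎)

    Lc′≡M : ℕtoℚ L ℚ.* c′ ≡ ℕtoℚ M
    Lc′≡M = *-cancelʳ-ℕtoℚ u (begin
      ℕtoℚ L ℚ.* c′ ℚ.* ℕtoℚ u      ≡⟨ ℚP.*-assoc (ℕtoℚ L) c′ (ℕtoℚ u) ⟩
      ℕtoℚ L ℚ.* (c′ ℚ.* ℕtoℚ u)    ≡⟨ cong (ℕtoℚ L ℚ.*_) (frac-* w u) ⟩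
      ℕtoℚ L ℚ.* ℕtoℚ w             ≡⟨ ℕtoℚ-homo-* L w ⟨
      ℕtoℚ (L ℕ.* w)                ≡⟨ cong ℕtoℚ (trans Lw≡uM (ℕP.*-comm u M)) ⟩
      ℕtoℚ (M ℕ.* u)                ≡⟨ ℕtoℚ-homo-* M u ⟩
      ℕtoℚ M ℚ.* ℕtoℚ u             ∎)

    w/uM*L≡1 : frac w (u ℕ.* M) ℚ.* ℕtoℚ L ≡ 1ℚ
    w/uM*L≡1 = *-cancelʳ-ℕtoℚ w (begin
      frac w (u ℕ.* M) ℚ.* ℕtoℚ L ℚ.* ℕtoℚ w    ≡⟨ ℚP.*-assoc (frac w (u ℕ.* M)) (ℕtoℚ L) (ℕtoℚ w) ⟩
      frac w (u ℕ.* M) ℚ.* (ℕtoℚ L ℚ.* ℕtoℚ w)  ≡⟨ cong (frac w (u ℕ.* M) ℚ.*_) (ℕtoℚ-homo-* L w) ⟨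
      frac w (u ℕ.* M) ℚ.* ℕtoℚ (L ℕ.* w)       ≡⟨ cong (λ e → frac w (u ℕ.* M) ℚ.* ℕtoℚ e) Lw≡uM ⟩
      frac w (u ℕ.* M) ℚ.* ℕtoℚ (u ℕ.* M)       ≡⟨ frac-* w (u ℕ.* M) {{uM≢0}} ⟩
      ℕtoℚ w                                    ≡⟨ ℚP.*-identityˡ (ℕtoℚ w) ⟨
      1ℚ ℚ.* ℕtoℚ w                             ∎)

  private
    aℚ dℚ Mℚ Lℚ w/uM : ℚ
    aℚ = ℕtoℚ a
    dℚ = ℕtoℚ d
    Mℚ = ℕtoℚ M
    Lℚ = ℕtoℚ L
    w/uM = frac w (u ℕ.* M)

    entry₁₁ : ∀ b → (c ℚ.* aℚ ℚ.+ 0ℚ ℚ.* 0ℚ) ℚ.* c′ ℚ.+ (c ℚ.* b ℚ.+ 0ℚ ℚ.* dℚ) ℚ.* (ℚ.- Mℚ) ≡ aℚ ℚ.- b ℚ.* Lℚ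
    entry₁₁ b = begin
      (c ℚ.* aℚ ℚ.+ 0ℚ ℚ.* 0ℚ) ℚ.* c′ ℚ.+ (c ℚ.* b ℚ.+ 0ℚ ℚ.* dℚ) ℚ.* (ℚ.- Mℚ)
        ≡⟨ expand c c′ aℚ dℚ b Mℚ ⟩
      aℚ ℚ.* (c ℚ.* c′) ℚ.- b ℚ.* (c ℚ.* Mℚ)
        ≡⟨ cong₂ (λ e f → aℚ ℚ.* e ℚ.- b ℚ.* f) cc′≡1 cM≡L ⟩
      aℚ ℚ.* 1ℚ ℚ.- b ℚ.* Lℚ
        ≡⟨ cong (ℚ._- b ℚ.* Lℚ) (ℚP.*-identityʳ aℚ) ⟩
      aℚ ℚ.- b ℚ.* Lℚ ∎
      where
      expand : ∀ c c′ a d b M → (c ℚ.* a ℚ.+ 0ℚ ℚ.* 0ℚ) ℚ.* c′ ℚ.+ (c ℚ.* b ℚ.+ 0ℚ ℚ.* d) ℚ.* (ℚ.- M) ≡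
                                a ℚ.* (c ℚ.* c′) ℚ.- b ℚ.* (c ℚ.* M)
      expand = RingSolver.solve-∀ ℚ-ring

    entry₁₂ : ∀ b → (c ℚ.* aℚ ℚ.+ 0ℚ ℚ.* 0ℚ) ℚ.* 0ℚ ℚ.+ (c ℚ.* b ℚ.+ 0ℚ ℚ.* dℚ) ℚ.* frac (u ℕ.* M) w ≡ b ℚ.* Lℚ ℚ.* c
    entry₁₂ b = trans (cong (λ e → (c ℚ.* aℚ ℚ.+ 0ℚ ℚ.* 0ℚ) ℚ.* 0ℚ ℚ.+ (c ℚ.* b ℚ.+ 0ℚ ℚ.* dℚ) ℚ.* e) uM/w≡L)
                      (expand c aℚ dℚ b Lℚ)
      where
      expand : ∀ c a d b L → (c ℚ.* a ℚ.+ 0ℚ ℚ.* 0ℚ) ℚ.* 0ℚ ℚ.+ (c ℚ.* b ℚ.+ 0ℚ ℚ.* d) ℚ.* L ≡ b ℚ.* L ℚ.* c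
      expand = RingSolver.solve-∀ ℚ-ring

    entry₂₁ : ∀ b → (1ℚ ℚ.* aℚ ℚ.+ w/uM ℚ.* 0ℚ) ℚ.* c′ ℚ.+ (1ℚ ℚ.* b ℚ.+ w/uM ℚ.* dℚ) ℚ.* (ℚ.- Mℚ) ≡
                    (aℚ ℚ.- dℚ ℚ.- b ℚ.* Lℚ) ℚ.* c′
    entry₂₁ b = begin
      (1ℚ ℚ.* aℚ ℚ.+ w/uM ℚ.* 0ℚ) ℚ.* c′ ℚ.+ (1ℚ ℚ.* b ℚ.+ w/uM ℚ.* dℚ) ℚ.* (ℚ.- Mℚ)
        ≡⟨ expand w/uM c′ aℚ dℚ b Mℚ ⟩
      aℚ ℚ.* c′ ℚ.- b ℚ.* Mℚ ℚ.- dℚ ℚ.* (w/uM ℚ.* Mℚ)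
        ≡⟨ cong₂ (λ e f → aℚ ℚ.* c′ ℚ.- b ℚ.* e ℚ.- dℚ ℚ.* f) (sym Lc′≡M) w/uM*M≡c′ ⟩
      aℚ ℚ.* c′ ℚ.- b ℚ.* (Lℚ ℚ.* c′) ℚ.- dℚ ℚ.* c′
        ≡⟨ collect c′ aℚ dℚ b Lℚ ⟩
      (aℚ ℚ.- dℚ ℚ.- b ℚ.* Lℚ) ℚ.* c′ ∎
      where
      expand : ∀ ι c′ a d b M → (1ℚ ℚ.* a ℚ.+ ι ℚ.* 0ℚ) ℚ.* c′ ℚ.+ (1ℚ ℚ.* b ℚ.+ ι ℚ.* d) ℚ.* (ℚ.- M) ≡
                                a ℚ.* c′ ℚ.- b ℚ.* M ℚ.- d ℚ.* (ι ℚ.* M)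
      expand = RingSolver.solve-∀ ℚ-ring
      collect : ∀ c′ a d b L → a ℚ.* c′ ℚ.- b ℚ.* (L ℚ.* c′) ℚ.- d ℚ.* c′ ≡ (a ℚ.- d ℚ.- b ℚ.* L) ℚ.* c′
      collect = RingSolver.solve-∀ ℚ-ring

    entry₂₂ : ∀ b → (1ℚ ℚ.* aℚ ℚ.+ w/uM ℚ.* 0ℚ) ℚ.* 0ℚ ℚ.+ (1ℚ ℚ.* b ℚ.+ w/uM ℚ.* dℚ) ℚ.* frac (u ℕ.* M) w ≡
                    dℚ ℚ.+ b ℚ.* Lℚ
    entry₂₂ b = begin
      (1ℚ ℚ.* aℚ ℚ.+ w/uM ℚ.* 0ℚ) ℚ.* 0ℚ ℚ.+ (1ℚ ℚ.* b ℚ.+ w/uM ℚ.* dℚ) ℚ.* frac (u ℕ.* M) w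
        ≡⟨ cong (λ e → (1ℚ ℚ.* aℚ ℚ.+ w/uM ℚ.* 0ℚ) ℚ.* 0ℚ ℚ.+ (1ℚ ℚ.* b ℚ.+ w/uM ℚ.* dℚ) ℚ.* e) uM/w≡L ⟩
      (1ℚ ℚ.* aℚ ℚ.+ w/uM ℚ.* 0ℚ) ℚ.* 0ℚ ℚ.+ (1ℚ ℚ.* b ℚ.+ w/uM ℚ.* dℚ) ℚ.* Lℚ
        ≡⟨ expand w/uM aℚ dℚ b Lℚ ⟩
      dℚ ℚ.* (w/uM ℚ.* Lℚ) ℚ.+ b ℚ.* Lℚ
        ≡⟨ cong (λ e → dℚ ℚ.* e ℚ.+ b ℚ.* Lℚ) w/uM*L≡1 ⟩
      dℚ ℚ.* 1ℚ ℚ.+ b ℚ.* Lℚ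
        ≡⟨ cong (ℚ._+ b ℚ.* Lℚ) (ℚP.*-identityʳ dℚ) ⟩
      dℚ ℚ.+ b ℚ.* Lℚ ∎
      where
      expand : ∀ ι a d b L → (1ℚ ℚ.* a ℚ.+ ι ℚ.* 0ℚ) ℚ.* 0ℚ ℚ.+ (1ℚ ℚ.* b ℚ.+ ι ℚ.* d) ℚ.* L ≡
                             d ℚ.* (ι ℚ.* L) ℚ.+ b ℚ.* L
      expand = RingSolver.solve-∀ ℚ-ring

  Pmat-form : ∀ b → let τ = b ℚ.* ℕtoℚ L in
              Pmat N u w a d b ≡ mat (ℕtoℚ a ℚ.- τ) (τ ℚ.* c) ((ℕtoℚ a ℚ.- ℕtoℚ d ℚ.- τ) ℚ.* c′) (ℕtoℚ d ℚ.+ τ)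
  Pmat-form b = trans (cong (λ m → (Sσ u w m *ℚ mat aℚ b 0ℚ dℚ) *ℚ Sσinv u w m) lcm≡Kw²)
                      (mat-cong (entry₁₁ b) (entry₁₂ b) (entry₂₁ b) (entry₂₂ b))

  open CuspMatrices (+ a) (+ d) (+ u) (+ w)

  Pmat-integral : ∀ {t} (ι : Integral t) b → b ℚ.* ℕtoℚ L ≡ ℤtoℚ t → Pmat N u w a d b ≡ toℚ X[ ι ]
  Pmat-integral {t} ι@(integral s m refl A-D-t≡mU) b τ≡t = trans (Pmat-form b) (mat-cong
    (begin
      ℕtoℚ a ℚ.- b ℚ.* ℕtoℚ L             ≡⟨ cong (λ e → ℕtoℚ a ℚ.- e) τ≡t ⟩
      ℕtoℚ a ℚ.- ℤtoℚ t                   ≡⟨ ℤtoℚ-homo-minus (+ a) t ⟨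
      ℤtoℚ (+ a - t)                      ∎)
    (begin
      b ℚ.* ℕtoℚ L ℚ.* c                  ≡⟨ cong (ℚ._* c) τ≡t ⟩
      ℤtoℚ (s * + w) ℚ.* c                ≡⟨ ℤtoℚ-*-frac s u w ⟩
      ℤtoℚ (s * + u)                      ∎)
    (begin
      (ℕtoℚ a ℚ.- ℕtoℚ d ℚ.- b ℚ.* ℕtoℚ L) ℚ.* c′  ≡⟨ cong (λ e → (ℕtoℚ a ℚ.- ℕtoℚ d ℚ.- e) ℚ.* c′) τ≡t ⟩
      (ℕtoℚ a ℚ.- ℕtoℚ d ℚ.- ℤtoℚ t) ℚ.* c′        ≡⟨ cong (ℚ._* c′) (ℤtoℚ-homo-minus₂ (+ a) (+ d) t) ⟨
      ℤtoℚ (+ a - + d - t) ℚ.* c′                  ≡⟨ cong (λ e → ℤtoℚ e ℚ.* c′) A-D-t≡mU ⟩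
      ℤtoℚ (m * + u) ℚ.* c′                        ≡⟨ ℤtoℚ-*-frac m w u ⟩
      ℤtoℚ (m * + w)                               ∎)
    (begin
      ℕtoℚ d ℚ.+ b ℚ.* ℕtoℚ L             ≡⟨ cong (ℕtoℚ d ℚ.+_) τ≡t ⟩
      ℕtoℚ d ℚ.+ ℤtoℚ t                   ≡⟨ ℤtoℚ-homo-+ (+ d) t ⟨
      ℤtoℚ (+ d + t)                      ∎))

  module _ (u⊥w : Coprime (+ u) (+ w)) where

    private
      w⊥u : Coprime (+ w) (+ u)
      w⊥u = ℤC.sym {+ u} {+ w} u⊥w

      swap-minus : ∀ {x y z} → x ℚ.- y ≡ z → y ≡ x ℚ.- z
      swap-minus {x} {y} refl = involution x y
        where
        involution : ∀ x y → y ≡ x ℚ.- (x ℚ.- y)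
        involution = RingSolver.solve-∀ ℚ-ring

    Pmat⇒integral : ∀ b Z → Pmat N u w a d b ≡ toℚ Z →
                    Σ ℤ λ t → Integral t × b ℚ.* ℕtoℚ L ≡ ℤtoℚ t
    Pmat⇒integral b (mat z11 z12 z21 z22) P≡Z = t , build W∣t U∣A-D-t , τ≡t
      where
      entries : mat (ℕtoℚ a ℚ.- b ℚ.* ℕtoℚ L) (b ℚ.* ℕtoℚ L ℚ.* c)
                    ((ℕtoℚ a ℚ.- ℕtoℚ d ℚ.- b ℚ.* ℕtoℚ L) ℚ.* c′) (ℕtoℚ d ℚ.+ b ℚ.* ℕtoℚ L) ≡
                toℚ (mat z11 z12 z21 z22)
      entries = trans (sym (Pmat-form b)) P≡Z
      t : ℤ
      t = + a - z11
      τ≡t : b ℚ.* ℕtoℚ L ≡ ℤtoℚ t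
      τ≡t = trans (swap-minus {ℕtoℚ a} {b ℚ.* ℕtoℚ L} (cong e11 entries)) (sym (ℤtoℚ-homo-minus (+ a) z11))
      W∣t : + w ∣ˢ t
      W∣t = coprime-divisorˢ (+ w) (+ u) t w⊥u (divides z12 (sym (trans
              (frac-cross t z12 u w (trans (cong (ℚ._* c) (sym τ≡t)) (cong e12 entries)))
              (ℤP.*-comm t (+ u)))))
      U∣A-D-t : + u ∣ˢ (+ a - + d - t)
      U∣A-D-t = coprime-divisorˢ (+ u) (+ w) (+ a - + d - t) u⊥w (divides z21 (sym (trans
              (frac-cross (+ a - + d - t) z21 w u
                (trans (cong (ℚ._* c′) (trans (ℤtoℚ-homo-minus₂ (+ a) (+ d) t)
                                              (cong (λ e → ℕtoℚ a ℚ.- ℕtoℚ d ℚ.- e) (sym τ≡t))))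
                       (cong e21 entries)))
              (ℤP.*-comm (+ a - + d - t) (+ w)))))
      build : + w ∣ˢ t → + u ∣ˢ (+ a - + d - t) → Integral t
      build (divides s t≡sW) (divides m A-D-t≡mU) = integral s m t≡sW A-D-t≡mU

module Scaled (L : ℕ) .{{_ : NonZero L}} {b t} (bL≡t : b ℚ.* ℕtoℚ L ≡ ℤtoℚ t) where

  open RationalEmbedding

  private instance
    L>0 : ℚ.Positive (ℕtoℚ L)
    L>0 = ℚ.positive (ℤtoℚ-mono-< (ℤ.+<+ (ℕ.>-nonZero⁻¹ L)))
    L≥0 : ℚ.NonNegative (ℕtoℚ L)
    L≥0 = ℚP.pos⇒nonNeg (ℕtoℚ L)

  0≤b⇒0≤t : 0ℚ ℚ.≤ b → 0ℤ ℤ.≤ t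
  0≤b⇒0≤t 0≤b = ℤtoℚ-cancel-≤ (subst₂ ℚ._≤_ (ℚP.*-zeroˡ (ℕtoℚ L)) bL≡t (ℚP.*-monoʳ-≤-nonNeg (ℕtoℚ L) 0≤b))

  0≤t⇒0≤b : 0ℤ ℤ.≤ t → 0ℚ ℚ.≤ b
  0≤t⇒0≤b 0≤t = ℚP.*-cancelʳ-≤-pos (ℕtoℚ L) (subst₂ ℚ._≤_ (sym (ℚP.*-zeroˡ (ℕtoℚ L))) (sym bL≡t) (ℤtoℚ-mono-≤ 0≤t))

  b<k⇒t<kL : ∀ k → b ℚ.< ℕtoℚ k → t ℤ.< + (k ℕ.* L)
  b<k⇒t<kL k b<k = ℤtoℚ-cancel-< (subst₂ ℚ._<_ bL≡t (sym (ℕtoℚ-homo-* k L)) (ℚP.*-monoˡ-<-pos (ℕtoℚ L) b<k))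

  t<kL⇒b<k : ∀ k → t ℤ.< + (k ℕ.* L) → b ℚ.< ℕtoℚ k
  t<kL⇒b<k k t<kL = ℚP.*-cancelʳ-<-nonNeg (ℕtoℚ L) (subst₂ ℚ._<_ (sym bL≡t) (ℕtoℚ-homo-* k L) (ℤtoℚ-mono-< t<kL))

module Classes (N n u w a d K : ℕ) .{{_ : NonZero n}} .{{u≢0 : NonZero u}} .{{w≢0 : NonZero w}} .{{K≢0 : NonZero K}}
               (lcm≡Kw² : lcm (w ℕ.* w) N ≡ K ℕ.* (w ℕ.* w)) (u⊥w : Coprime (+ u) (+ w))
               (gcd[n,N]≡1 : gcd n N ≡ 1) (0<a : 0 ℕ.< a) (ad≡n : a ℕ.* d ≡ n) (a≢d : a ≢ d) where

  open import Data.Integer using (_+_; _*_; _-_; -_)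
  open RationalEmbedding
  open Arithmetic
  open Matrices
  open HermiteDecomposition
  open ConjugatedTriangular N u w a d K lcm≡Kw²
  open CuspMatrices (+ a) (+ d) (+ u) (+ w)
  open Admissibility (+ N) (+ K) public

  |Δ| : ℕ
  |Δ| = ℤ.∣ + a - + d ∣

  private
    open ≡-Reasoning

    instance
      L≢0 : NonZero L
      L≢0 = ℕP.m*n≢0 u (K ℕ.* w) {{u≢0}} {{ℕP.m*n≢0 K w {{K≢0}} {{w≢0}}}}

    A≢D : + a ≢ + d
    A≢D = a≢d ∘ ℤP.+-injective

    L≡UKW : + L ≡ + u * + K * + w
    L≡UKW = trans (ℤP.pos-* u (K ℕ.* w)) (trans (cong (+ u *_) (ℤP.pos-* K w)) (sym (ℤP.*-assoc (+ u) (+ K) (+ w))))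

    N∣KW² : (+ N) ∣ˢ + K * (+ w * + w)
    N∣KW² = subst ((+ N) ∣ˢ_) (trans (ℤP.pos-* K (w ℕ.* w)) (cong (+ K *_) (ℤP.pos-* w w)))
                  (∣ᵤ⇒∣ {+ N} {+ (K ℕ.* (w ℕ.* w))} (subst (N ℕD.∣_) lcm≡Kw² (n∣lcm[m,n] (w ℕ.* w) N)))

    K-index : ∀ σ → (+ N) ∣ˢ σ * (+ w * + w) → (+ K) ∣ˢ σ
    K-index σ N∣σw² = ∣ᵤ⇒∣ {+ K} {σ} (ℕD.*-cancelʳ-∣ (w ℕ.* w) {{ℕP.m*n≢0 w w}}
      (subst (ℕD._∣ ℤ.∣ σ ∣ ℕ.* (w ℕ.* w)) lcm≡Kw² (lcm-least (ℕD.n∣m*n ℤ.∣ σ ∣) N∣∣σ∣w²)))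
      where
      N∣∣σ∣w² : N ℕD.∣ ℤ.∣ σ ∣ ℕ.* (w ℕ.* w)
      N∣∣σ∣w² = subst (N ℕD.∣_) (trans (ℤP.abs-* σ (+ w * + w)) (cong (ℤ.∣ σ ∣ ℕ.*_) (ℤP.abs-* (+ w) (+ w))))
                      (∣⇒∣ᵤ N∣σw²)

  hyperbolic : ∀ {t} (ι : Integral t) → Hyperbolic n (toℚ X[ ι ])
  hyperbolic {t} ι@(integral _ _ _ _) =
    subst₂ ℚ._<_ (cong ℤtoℚ 4ad≡4n) trace² (ℤtoℚ-mono-< (4ij<[i+j]² (+ a) (+ d) A≢D))
    where
    4ad≡4n : + 4 * (+ a * + d) ≡ + (4 ℕ.* n)
    4ad≡4n = trans (cong (+ 4 *_) (trans (sym (ℤP.pos-* a d)) (cong +_ ad≡n))) (sym (ℤP.pos-* 4 n))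
    redistribute : ∀ x y t → x + y ≡ (x - t) + (y + t)
    redistribute x y t = solve (x ∷ y ∷ t ∷ [])
    trace≡ : ℤtoℚ (+ a + + d) ≡ trace (toℚ X[ ι ])
    trace≡ = trans (cong ℤtoℚ (redistribute (+ a) (+ d) t)) (ℤtoℚ-homo-+ (+ a - t) (+ d + t))
    trace² : ℤtoℚ ((+ a + + d) * (+ a + + d)) ≡ trace (toℚ X[ ι ]) ℚ.* trace (toℚ X[ ι ])
    trace² = trans (ℤtoℚ-homo-* (+ a + + d) (+ a + + d)) (cong₂ ℚ._*_ trace≡ trace≡)

  admissible⇒good : ∀ {t} b → Admissible t → b ℚ.* ℕtoℚ L ≡ ℤtoℚ t → 0ℤ ℤ.≤ t → t ℤ.< + (|Δ| ℕ.* L) →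
                    Good N n u w a d b
  admissible⇒good {t} b (ι , N∣e21) bL≡t 0≤t t<ΔL =
    0≤t⇒0≤b 0≤t , t<kL⇒b<k |Δ| t<ΔL ,
    transport (InΓstar N n) (hermite-decomposition N n gcd[n,N]≡1 X[ ι ] det≡n (∣⇒∣ᵤ N∣e21)) ,
    transport (Hyperbolic n) (hyperbolic ι) ,
    transport (λ Y → Fixes Y (frac u w)) (eigenvector⇒fixes u w X[ ι ] (+ a) (X-eigenvector ι) a≢0) ,
    transport (TrivialCentralizer N) (λ γ (det≡1 , _) γX≡Xγ →
      centraliser-trivial A≢D u⊥w ι γ det≡1 (toℚ-commute⇒commute γ X[ ι ] γX≡Xγ))
    where
    open Scaled L {b} {t} bL≡t
    transport : ∀ (P : Mat ℚ → Set) → P (toℚ X[ ι ]) → P (Pmat N u w a d b)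
    transport P = subst P (sym (Pmat-integral ι b bL≡t))
    det≡n : det X[ ι ] ≡ + n
    det≡n = trans (det-X ι) (trans (sym (ℤP.pos-* a d)) (cong +_ ad≡n))
    a≢0 : + a ≢ 0ℤ
    a≢0 a≡0 = ℕP.<⇒≢ 0<a (sym (ℤP.+-injective a≡0))

  good⇒admissible : ∀ b → Good N n u w a d b →
                    Σ ℤ λ t → Admissible t × b ℚ.* ℕtoℚ L ≡ ℤtoℚ t × 0ℤ ℤ.≤ t × t ℤ.< + (|Δ| ℕ.* L)
  good⇒admissible b (0≤b , b<Δ , (a′ , d′ , b′ , γ , _ , _ , _ , _ , (_ , N∣γ21) , P≡Z) , _) =
    t , (ι , subst (λ Y → (+ N) ∣ˢ e21 Y) Z≡X N∣Z21) , bL≡t , 0≤b⇒0≤t 0≤b , b<k⇒t<kL |Δ| b<Δ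
    where
    Z : Mat ℤ
    Z = mat (+ d′) (- + b′) (+ 0) (+ a′) *ℤ γ
    integral-part : Σ ℤ λ t → Integral t × b ℚ.* ℕtoℚ L ≡ ℤtoℚ t
    integral-part = Pmat⇒integral u⊥w b Z P≡Z
    t : ℤ
    t = proj₁ integral-part
    ι : Integral t
    ι = proj₁ (proj₂ integral-part)
    bL≡t : b ℚ.* ℕtoℚ L ≡ ℤtoℚ t
    bL≡t = proj₂ (proj₂ integral-part)
    open Scaled L {b} {t} bL≡t
    Z≡X : Z ≡ X[ ι ]
    Z≡X = toℚ-injective (trans (sym P≡Z) (Pmat-integral ι b bL≡t))
    N∣Z21 : (+ N) ∣ˢ e21 Z
    N∣Z21 = ∣m∣n⇒∣m+n (∣m⇒∣m*n (e11 γ) (divides 0ℤ refl)) (∣n⇒∣m*n (+ a′) (∣ᵤ⇒∣ N∣γ21))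

  conjugate⇒congruent : ∀ {t t′} b b′ → Admissible t → Admissible t′ →
                        b ℚ.* ℕtoℚ L ≡ ℤtoℚ t → b′ ℚ.* ℕtoℚ L ≡ ℤtoℚ t′ →
                        Conj N (Pmat N u w a d b) (Pmat N u w a d b′) →
                        Σ ℤ λ ε → Σ ℤ λ e → IsSign ε × ε * (t′ - t) ≡ e * + L * (+ a - + d)
  conjugate⇒congruent {t} {t′} b b′ (ι , _) (ι′ , _) bL≡t b′L≡t′ (γ , (det≡1 , N∣γ21) , γPγ⁻¹≡P′) =
    from-form (intertwiner-form A≢D u⊥w ι ι′ γ det≡1 γX≡X′γ)
    where
    γX≡X′γ : γ *ℤ X[ ι ] ≡ X[ ι′ ] *ℤ γ
    γX≡X′γ = conjugate⇒intertwines γ X[ ι ] X[ ι′ ] det≡1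
      (subst₂ (λ X Y → (toℚ γ *ℚ X) *ℚ toℚ (adj γ) ≡ Y) (Pmat-integral ι b bL≡t) (Pmat-integral ι′ b′ b′L≡t′) γPγ⁻¹≡P′)
    from-form : (Σ ℤ λ ε → Σ ℤ λ β → IsSign ε × γ ≡ stabiliser A≢D u⊥w ε β ×
                                   ε * (t′ - t) ≡ β * + u * + w * (+ a - + d)) →
                Σ ℤ λ ε → Σ ℤ λ e → IsSign ε × ε * (t′ - t) ≡ e * + L * (+ a - + d)
    from-form (ε , β , ε-sign , γ≡stab , shift) = via-K (K-index β N∣βw²)
      where
      N∣βw² : (+ N) ∣ˢ β * (+ w * + w)
      N∣βw² = subst ((+ N) ∣ˢ_) (trans (cong e21 γ≡stab) (ℤP.*-assoc β (+ w) (+ w))) (∣ᵤ⇒∣ N∣γ21)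
      via-K : (+ K) ∣ˢ β → Σ ℤ λ ε → Σ ℤ λ e → IsSign ε × ε * (t′ - t) ≡ e * + L * (+ a - + d)
      via-K (divides e β≡eK) = ε , e , ε-sign , (begin
        ε * (t′ - t)                      ≡⟨ shift ⟩
        β * + u * + w * (+ a - + d)       ≡⟨ cong (λ x → x * (+ a - + d)) (begin
          β * + u * + w                     ≡⟨ ℤP.*-assoc β (+ u) (+ w) ⟩
          β * (+ u * + w)                   ≡⟨ cong (_* (+ u * + w)) β≡eK ⟩
          e * + K * (+ u * + w)             ≡⟨ rescale e (+ K) (+ u) (+ w) ⟩
          e * (+ u * + K * + w)             ≡⟨ cong (e *_) L≡UKW ⟨
          e * + L                           ∎) ⟩
        e * + L * (+ a - + d)             ∎)
        where
        rescale : ∀ e k u w → e * k * (u * w) ≡ e * (u * k * w)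
        rescale e k u w = solve (e ∷ k ∷ u ∷ w ∷ [])

  admissible-exists : ∀ Nw → N ≡ Nw ℕ.* w → (+ gcd w Nw) ℤD.∣ (+ a - + d) → Σ ℤ Admissible
  admissible-exists Nw N≡Nww g∣Δ = from-bézout (bézout-ℕ w (u ℕ.* Nw)) (∣ᵤ⇒∣ (ℕD.∣-trans g′∣g g∣Δ))
    where
    g′ : ℕ
    g′ = gcd w (u ℕ.* Nw)
    g′⊥u : ℕC.Coprime g′ u
    g′⊥u (k∣g′ , k∣u) = u⊥w (k∣u , ℕD.∣-trans k∣g′ (gcd[m,n]∣m w (u ℕ.* Nw)))
    g′∣g : g′ ℕD.∣ gcd w Nw
    g′∣g = gcd-greatest (gcd[m,n]∣m w (u ℕ.* Nw)) (ℕC.coprime-divisor g′⊥u (gcd[m,n]∣n w (u ℕ.* Nw)))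
    from-bézout : (Σ ℤ λ P → Σ ℤ λ Q → P * + w + Q * + (u ℕ.* Nw) ≡ + g′) → (+ g′) ∣ˢ (+ a - + d) →
                  Σ ℤ Admissible
    from-bézout (P , Q , bz) (divides h Δ≡hg′) =
      P * + w * h , admissible-from-bézout (+ Nw) P Q h (trans (cong +_ N≡Nww) (ℤP.pos-* Nw w)) (begin
        + a - + d                          ≡⟨ Δ≡hg′ ⟩
        h * + g′                           ≡⟨ cong (h *_) bz ⟨
        h * (P * + w + Q * + (u ℕ.* Nw))   ≡⟨ cong (λ x → h * (P * + w + Q * x)) (ℤP.pos-* u Nw) ⟩
        h * (P * + w + Q * (+ u * + Nw))   ∎)

  module Representatives (t₀ : ℤ) (α₀ : Admissible t₀) where

    private
      r : ℕ
      r = t₀ %ℕ L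
      q : ℤ
      q = t₀ /ℕ L

    rep-t : ℕ → ℤ
    rep-t i = + r + + i * + L

    rep : Fin |Δ| → ℚ
    rep i = frac (r ℕ.+ toℕ i ℕ.* L) L

    private
      regroup : ∀ r q i l → r + q * l + (i - q) * l ≡ r + i * l
      regroup r q i l = solve (r ∷ q ∷ i ∷ l ∷ [])

      difference : ∀ r i j l → (r + j * l) - (r + i * l) ≡ (j - i) * l
      difference r i j l = solve (r ∷ i ∷ j ∷ l ∷ [])

      pos-rep-t : ∀ i → + (r ℕ.+ i ℕ.* L) ≡ rep-t i
      pos-rep-t i = trans (ℤP.pos-+ r (i ℕ.* L)) (cong (λ x → + r + x) (ℤP.pos-* i L))

    rep-scaled : ∀ i → rep i ℚ.* ℕtoℚ L ≡ ℤtoℚ (rep-t (toℕ i))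
    rep-scaled i = trans (frac-* (r ℕ.+ toℕ i ℕ.* L) L) (cong ℤtoℚ (pos-rep-t (toℕ i)))

    rep-admissible : ∀ i → Admissible (rep-t i)
    rep-admissible i = subst Admissible t₀+[i-q]L≡ (admissible-shift N∣KW² α₀ (+ i - q))
      where
      t₀+[i-q]L≡ : t₀ + (+ i - q) * (+ u * + K * + w) ≡ rep-t i
      t₀+[i-q]L≡ = begin
        t₀ + (+ i - q) * (+ u * + K * + w)   ≡⟨ cong₂ (λ x y → x + (+ i - q) * y) (sym (a≡a%ℕn+[a/ℕn]*n t₀ L)) L≡UKW ⟨
        + r + q * + L + (+ i - q) * + L       ≡⟨ regroup (+ r) q (+ i) (+ L) ⟩
        + r + + i * + L                       ∎

    rep-good : ∀ i → Good N n u w a d (rep i)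
    rep-good i = admissible⇒good (rep i) (rep-admissible (toℕ i)) (rep-scaled i)
      (subst (0ℤ ℤ.≤_) (pos-rep-t (toℕ i)) (ℤ.+≤+ ℕ.z≤n))
      (subst (ℤ._< + (|Δ| ℕ.* L)) (pos-rep-t (toℕ i))
        (ℤ.+<+ (ℕP.<-≤-trans (ℕP.+-monoˡ-< (toℕ i ℕ.* L) (n%ℕd<d t₀ L)) (ℕP.*-monoˡ-≤ L (FinP.toℕ<n i)))))

    rep-injective : ∀ i j → Conj N (Pmat N u w a d (rep i)) (Pmat N u w a d (rep j)) → i ≡ j
    rep-injective i j conj = from-congruence
      (conjugate⇒congruent (rep i) (rep j) (rep-admissible (toℕ i)) (rep-admissible (toℕ j))
                           (rep-scaled i) (rep-scaled j) conj)
      where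
      i′ j′ : ℤ
      i′ = + toℕ i
      j′ = + toℕ j
      from-congruence : (Σ ℤ λ ε → Σ ℤ λ e → IsSign ε × ε * (rep-t (toℕ j) - rep-t (toℕ i)) ≡ e * + L * (+ a - + d)) →
                        i ≡ j
      from-congruence (ε , e , ε-sign , shift) = sym (FinP.toℕ-injective
        (difference-divisible⇒≡ (toℕ j) (toℕ i) (FinP.toℕ<n j) (FinP.toℕ<n i) (∣⇒∣ᵤ (divides (ε * e) j′-i′≡))))
        where
        ε[j′-i′]≡eΔ : ε * (j′ - i′) ≡ e * (+ a - + d)
        ε[j′-i′]≡eΔ = ℤP.*-cancelʳ-≡ _ _ (+ L) (begin
          ε * (j′ - i′) * + L                        ≡⟨ ℤP.*-assoc ε (j′ - i′) (+ L) ⟩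
          ε * ((j′ - i′) * + L)                      ≡⟨ cong (ε *_) (difference (+ r) i′ j′ (+ L)) ⟨
          ε * (rep-t (toℕ j) - rep-t (toℕ i))      ≡⟨ shift ⟩
          e * + L * (+ a - + d)                    ≡⟨ swap e (+ L) (+ a - + d) ⟩
          e * (+ a - + d) * + L                    ∎)
          where
          swap : ∀ x y z → x * y * z ≡ x * z * y
          swap x y z = solve (x ∷ y ∷ z ∷ [])
        j′-i′≡ : j′ - i′ ≡ ε * e * (+ a - + d)
        j′-i′≡ = trans (ε*x≡y⇒x≡ε*y ε-sign ε[j′-i′]≡eΔ) (sym (ℤP.*-assoc ε e (+ a - + d)))

    rep-surjective : ∀ b → Good N n u w a d b → Σ (Fin |Δ|) λ i → Conj N (Pmat N u w a d b) (Pmat N u w a d (rep i))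
    rep-surjective b good = from-admissible (good⇒admissible b good)
      where
      from-admissible : (Σ ℤ λ t → Admissible t × b ℚ.* ℕtoℚ L ≡ ℤtoℚ t × 0ℤ ℤ.≤ t × t ℤ.< + (|Δ| ℕ.* L)) →
                        Σ (Fin |Δ|) λ i → Conj N (Pmat N u w a d b) (Pmat N u w a d (rep i))
      from-admissible (t , α , bL≡t , 0≤t , t<ΔL) =
        from-index (window-index L r |Δ| (q + e) (n%ℕd<d t₀ L)
                                 (subst (0ℤ ℤ.≤_) t≡ 0≤t) (subst (ℤ._< + (|Δ| ℕ.* L)) t≡ t<ΔL))
        where
        congruent : Σ ℤ λ e → t - t₀ ≡ e * (+ u * + K * + w)
        congruent = admissible-congruent u⊥w K-index α α₀
        e : ℤ
        e = proj₁ congruent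
        t≡ : t ≡ + r + (q + e) * + L
        t≡ = begin
          t                                    ≡⟨ solve (t ∷ t₀ ∷ []) ⟩
          t₀ + (t - t₀)                        ≡⟨ cong₂ _+_ (a≡a%ℕn+[a/ℕn]*n t₀ L) (proj₂ congruent) ⟩
          + r + q * + L + e * (+ u * + K * + w) ≡⟨ cong (λ x → + r + q * + L + e * x) L≡UKW ⟨
          + r + q * + L + e * + L              ≡⟨ collect (+ r) q e (+ L) ⟩
          + r + (q + e) * + L                  ∎
          where
          collect : ∀ r q e l → r + q * l + e * l ≡ r + (q + e) * l
          collect r q e l = solve (r ∷ q ∷ e ∷ l ∷ [])
        from-index : (Σ ℕ λ j → q + e ≡ + j × j ℕ.< |Δ|) →
                     Σ (Fin |Δ|) λ i → Conj N (Pmat N u w a d b) (Pmat N u w a d (rep i))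
        from-index (j , q+e≡j , j<Δ) =
          fromℕ< j<Δ , subst (λ x → Conj N (Pmat N u w a d b) (Pmat N u w a d x)) b≡rep (Conj-refl N _)
          where
          b≡rep : b ≡ rep (fromℕ< j<Δ)
          b≡rep = *-cancelʳ-ℕtoℚ L (begin
            b ℚ.* ℕtoℚ L                       ≡⟨ bL≡t ⟩
            ℤtoℚ t                             ≡⟨ cong ℤtoℚ (trans t≡ (cong (λ x → + r + x * + L) q+e≡j)) ⟩
            ℤtoℚ (rep-t j)                     ≡⟨ cong (ℤtoℚ ∘ rep-t) (FinP.toℕ-fromℕ< j<Δ) ⟨
            ℤtoℚ (rep-t (toℕ (fromℕ< j<Δ)))    ≡⟨ rep-scaled (fromℕ< j<Δ) ⟨
            rep (fromℕ< j<Δ) ℚ.* ℕtoℚ L        ∎)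

    exactly-|Δ|-classes : ExactlyClasses N n u w a d |Δ|
    exactly-|Δ|-classes = rep , rep-good , rep-injective , rep-surjective

open import Data.Nat using (ℕ; NonZero; _<_; _*_; _/_)
open import Data.Nat.GCD using (gcd)
open import Data.Nat.Divisibility using (_∣_)
open import Data.Integer using (+_; _-_; ∣_∣)
open import Data.Integer.Divisibility renaming (_∣_ to _∣ℤ_)
open import Relation.Nullary using (¬_)
open import Relation.Binary.PropositionalEquality using (_≡_; _≢_)

lemma3p5 : (N n : ℕ) → 1 < N → ¬ SquareFree N → 0 < n → gcd n N ≡ 1 →
           (u w : ℕ) → .{{_ : NonZero w}} → 0 < u → gcd u w ≡ 1 → w ∣ N →
           (a d : ℕ) → 0 < a → 0 < d → a * d ≡ n → a ≢ d →
           (+ gcd w (N / w)) ∣ℤ ((+ a) - (+ d)) →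
           ExactlyClasses N n u w a d ∣ (+ a) - (+ d) ∣
lemma3p5 N n 1<N _ 0<n gcd[n,N]≡1 u w 0<u gcd[u,w]≡1 (ℕD.divides Nw N≡Nw*w) a d 0<a _ ad≡n a≢d g∣a-d =
  exactly-|Δ|-classes
  where
  instance
    n≢0 : NonZero n
    n≢0 = ℕ.>-nonZero 0<n
    u≢0 : NonZero u
    u≢0 = ℕ.>-nonZero 0<u
    N≢0 : NonZero N
    N≢0 = ℕ.>-nonZero (ℕP.<-trans (ℕ.s≤s ℕ.z≤n) 1<N)
    w²≢0 : NonZero (w * w)
    w²≢0 = ℕP.m*n≢0 w w
  cofactor : Σ ℕ λ K → NonZero K × lcm (w * w) N ≡ K * (w * w)
  cofactor = Arithmetic.lcm-cofactor (w * w) N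
  K : ℕ
  K = proj₁ cofactor
  instance
    K≢0 : NonZero K
    K≢0 = proj₁ (proj₂ cofactor)
  open Classes N n u w a d K (proj₂ (proj₂ cofactor)) (ℕC.gcd≡1⇒coprime gcd[u,w]≡1) gcd[n,N]≡1 0<a ad≡n a≢d
  N/w≡Nw : N / w ≡ Nw
  N/w≡Nw = trans (cong (_/ w) N≡Nw*w) (m*n/n≡m Nw w)
  admissible : Σ ℤ Admissible
  admissible = admissible-exists Nw N≡Nw*w (subst (λ x → (+ gcd w x) ∣ℤ (+ a - + d)) N/w≡Nw g∣a-d)
  open Representatives (proj₁ admissible) (proj₂ admissible)
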